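{- Let $k\ge 2$, let $\lambda$ be an almost self-conjugate partition of rank $d$, and let $\mu=(k^d1^e)$ be a partition with $|\mu|=|\lambda|$. Write the Frobenius coordinates of $\lambda$ as $(f_1,\ldots,f_d\mid f_1-1,\ldots,f_d-1)$ and set $f_{d+1}=0$. Then $\mathrm{SRHT}(\lambda,\mu)$ is nonempty if and only if (1) $f_j+f_{d+1-j}\ge k$ for $1\le j\le d$, and (2) $f_{j+1}+f_{d+1-j}<k$ for $1\le j\le d$.
   Context: For a partition $\lambda$, $\lambda'$ is its conjugate, and its rank is the largest $i$ with $\lambda_i\ge i$. If the rank is $r$, the Frobenius coordinates of $\lambda$ are $(\lambda_1-1,\ldots,\lambda_r-r\mid\lambda'_1-1,\ldots,\lambda'_r-r)$. $\lambda$ is almost self-conjugate (ASC) if $\lambda_i=\lambda'_i+1$ for $1\le i\le$ rank$(\lambda)$. $(k^d1^e)$ is the partition with $d$ parts equal to $k$ and $e$ parts equal to $1$. A ribbon is a connected skew shape containing no $2\times 2$ square of cells (the empty ribbon is allowed); an $m$-ribbon has $m$ cells; its sign is $(-1)^{(\text{number of rows it occupies})-1}$. A rim-hook tableau of shape $\lambda$ and content $\alpha=(\alpha_1,\ldots,\alpha_\ell)$ is a chain of partitions $\emptyset=\nu^0\subseteq\nu^1\subseteq\cdots\subseteq\nu^\ell=\lambda$ with each $\nu^i/\nu^{i-1}$ an $\alpha_i$-ribbon. For partitions $\lambda,\mu$ of the same size, a special rim-hook tableau of shape $\lambda$ and type $\mu$ is a rim-hook tableau of shape $\lambda$ whose content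 sorted into weakly decreasing order equals $\mu$ and each of whose nonempty ribbons contains a cell in the first column of the Young diagram of $\lambda$; $\mathrm{SRHT}(\lambda,\mu)$ is the set of these. -}

module Defs where

open import Data.Nat using (ℕ; zero; suc; _+_; _∸_; _≤_; _<_; _≥_; _≤?_; _≤ᵇ_)
open import Data.Bool using (if_then_else_)
open import Data.List using (List; []; _∷_; _++_; [_]; length; filter; replicate)
open import Data.List.Relation.Unary.All using (All)
open import Data.List.Relation.Unary.Linked using (Linked)
open import Data.List.Relation.Binary.Permutation.Propositional using (_↭_)
open import Data.Product using (Σ; _×_; _,_; ∃)
open import Data.Sum using (_⊎_)
open import Data.Empty using (⊥)
open import Data.Unit using (⊤)
open import Data.Nat.ListAction using (sum)
open import Relation.Nullary using (¬_)
open import Relation.Binary.PropositionalEquality using (_≡_)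

IsPartition : List ℕ → Set
IsPartition xs = Linked _≥_ xs × All (λ x → 1 ≤ x) xs

-- λ_i, 1-indexed (λ_0 := 0 unused, λ_i := 0 beyond the length)
part : List ℕ → ℕ → ℕ
part xs zero = 0
part [] (suc i) = 0
part (x ∷ xs) (suc zero) = x
part (x ∷ xs) (suc (suc i)) = part xs (suc i)

conjPart : List ℕ → ℕ → ℕ
conjPart xs i = length (filter (λ x → i ≤? x) xs)

HasRank : List ℕ → ℕ → Set
HasRank xs d = (d ≡ 0 ⊎ part xs d ≥ d) × (∀ i → d < i → part xs i < i)

IsASC : List ℕ → ℕ → Set
IsASC xs d = ∀ i → 1 ≤ i → i ≤ d → part xs i ≡ conjPart xs i + 1

-- f_j = λ_j - j for 1 ≤ j ≤ d (the arm Frobenius coordinates), f_j = 0 for j > d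
-- (in particular f_{d+1} = 0).
frob : List ℕ → ℕ → ℕ → ℕ
frob xs d j = if j ≤ᵇ d then part xs j ∸ j else 0

kd1e : ℕ → ℕ → ℕ → List ℕ
kd1e k d e = replicate d k ++ replicate e 1

-- Young diagrams (0-indexed cells (row , column)) and skew shapes

Cell : Set
Cell = ℕ × ℕ

InDiagram : List ℕ → Cell → Set
InDiagram [] _ = ⊥
InDiagram (x ∷ xs) (zero , j) = j < x
InDiagram (x ∷ xs) (suc i , j) = InDiagram xs (i , j)

_⊆ᵈ_ : List ℕ → List ℕ → Set
ρ ⊆ᵈ ν = ∀ c → InDiagram ρ c → InDiagram ν c

InSkew : List ℕ → List ℕ → Cell → Set
InSkew ν ρ c = InDiagram ν c × ¬ InDiagram ρ c

data Adj : Cell → Cell → Set where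
  right : ∀ {i j} → Adj (i , j) (i , suc j)
  left  : ∀ {i j} → Adj (i , suc j) (i , j)
  down  : ∀ {i j} → Adj (i , j) (suc i , j)
  up    : ∀ {i j} → Adj (suc i , j) (i , j)

data Reach (S : Cell → Set) : Cell → Cell → Set where
  here : ∀ {a} → Reach S a a
  step : ∀ {a b c} → Adj a b → S b → Reach S b c → Reach S a c

Connected : (Cell → Set) → Set
Connected S = ∀ a b → S a → S b → Reach S a b

No2x2 : (Cell → Set) → Set
No2x2 S = ∀ i j → ¬ (S (i , j) × S (i , suc j) × S (suc i , j) × S (suc i , suc j))

-- ν / ρ is a ribbon (possibly empty)
IsRibbon : List ℕ → List ℕ → Set
IsRibbon ν ρ = ρ ⊆ᵈ ν × Connected (InSkew ν ρ) × No2x2 (InSkew ν ρ)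

-- number of cells of ν / ρ  (= |ν| - |ρ| when ρ ⊆ ν)
skewSize : List ℕ → List ℕ → ℕ
skewSize ν ρ = sum ν ∸ sum ρ

-- Rim-hook tableaux: chains ∅ = ν⁰ ⊆ ν¹ ⊆ … ⊆ νˡ, each step an αᵢ-ribbon.
-- RHT ν α : rim-hook tableau of shape ν and content α.

data RHT : List ℕ → List ℕ → Set where
  empty : RHT [] []
  add   : ∀ {ρ α} (ν : List ℕ) (m : ℕ) → RHT ρ α →
          IsPartition ν → IsRibbon ν ρ → skewSize ν ρ ≡ m →
          RHT ν (α ++ [ m ])

RibbonsMeetFirstColumn : ∀ {ν α} → RHT ν α → Set
RibbonsMeetFirstColumn empty = ⊤
RibbonsMeetFirstColumn (add {ρ} ν m t _ _ _) =
  (m ≡ 0 ⊎ ∃ (λ i → InSkew ν ρ (i , 0))) × RibbonsMeetFirstColumn t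

SortsDecreasingTo : List ℕ → List ℕ → Set
SortsDecreasingTo α β = (α ↭ β) × Linked _≥_ β

SRHTNonempty : List ℕ → List ℕ → Set
SRHTNonempty lam mu =
  Σ (List ℕ) λ α → Σ (RHT lam α) λ t →
    SortsDecreasingTo α mu × RibbonsMeetFirstColumn t

{-# OPTIONS --safe #-}

-- Place λ on an abacus with N = length λ beads, row i carrying a bead at λ_i + N − 1 − i.
-- Removing a rim hook that meets the first column moves one bead down onto the lowest gap,
-- by the size of the hook. The beads at positions ≥ N are one per row of the Durfee square,
-- and as N itself is a gap, such a bead can only be moved by a k-hook: a decomposition into
-- first-column hooks of sizes k and 1 uses at least rank λ hooks of size k, and one with
-- exactly rank λ of them exists iff λ is tight: at every gap q ≤ N the beads in [N, q + k)
-- are as many as the gaps below q (necessary by induction on the decomposition, sufficient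
-- by a greedy construction). For almost self-conjugate λ the gaps below N are the positions
-- N − f_j, and tightness at N − f_j says that f_i + f_j ≥ k for exactly d + 1 − j indices i.
-- As the f_i decrease, this is conditions (1) and (2); the case j = d of (2) is tightness at
-- the gap N.

module Submission where

open import Defs
open import Data.Bool using (T; true; false)
open import Data.Empty using (⊥)
open import Data.List using (List; []; _∷_; _++_; [_]; length; filter; replicate)
open import Data.List.Properties using (length-filter; filter-accept; filter-reject; filter-++; length-++)
open import Data.List.Relation.Binary.Permutation.Propositional using (_↭_; ↭-refl; ↭-prep; ↭-trans; ↭-sym)
open import Data.List.Relation.Binary.Permutation.Propositional.Properties using (All-resp-↭; shift; filter-↭; ↭-length)
open import Data.List.Relation.Unary.All using (All; []; _∷_)
open import Data.List.Relation.Unary.All.Properties using (++⁺; ++⁻ˡ; ++⁻ʳ; replicate⁺)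
open import Data.List.Relation.Unary.Linked using (Linked; []; [-]; _∷_)
import Data.List.Relation.Unary.Linked as Linked
open import Data.Nat
open import Data.Nat.ListAction using (sum)
open import Data.Nat.ListAction.Properties using (sum-++)
open import Data.Nat.Properties
open import Data.Nat.Tactic.RingSolver using (solve-∀)
open import Data.Product using (Σ-syntax; _×_; _,_; proj₁; proj₂; uncurry)
open import Data.Sum using (_⊎_; inj₁; inj₂)
open import Function using (_∘_)
open import Function.Bundles using (_⇔_; mk⇔; Equivalence)
open import Relation.Binary.PropositionalEquality hiding ([_])
open import Relation.Nullary using (¬_; Dec; yes; no; contradiction)
open import Relation.Nullary.Decidable using (_×-dec_; _⊎-dec_)

suc[n∸1]≡n : ∀ {n} → 1 ≤ n → suc (n ∸ 1) ≡ n
suc[n∸1]≡n (s≤s _) = refl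

suc[m∸1+n]≡m∸n : ∀ {m n} → n < m → suc (m ∸ suc n) ≡ m ∸ n
suc[m∸1+n]≡m∸n n<m = sym (+-∸-assoc 1 n<m)

+-≡⇒≤-swap : ∀ {a t b u} → a + t ≡ b + u → a ≤ b → u ≤ t
+-≡⇒≤-swap {a} {t} {b} {u} eq a≤b = +-cancelˡ-≤ b u t (≤-trans (≤-reflexive (sym eq)) (+-monoˡ-≤ t a≤b))

+-≡⇒<-swap : ∀ {a t b u} → a + t ≡ b + u → a < b → u < t
+-≡⇒<-swap {a} {t} {b} {u} eq = +-≡⇒≤-swap (trans (cong suc eq) (sym (+-suc b u)))

m≤n∧o≤p∧m+o≡n+p⇒m≡n×o≡p : ∀ {m n o p} → m ≤ n → o ≤ p → m + o ≡ n + p → m ≡ n × o ≡ p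
m≤n∧o≤p∧m+o≡n+p⇒m≡n×o≡p {m} {n} {o} {p} m≤n o≤p eq =
  ≤-antisym m≤n (+-≡⇒≤-swap (trans (+-comm o m) (trans eq (+-comm n p))) o≤p) ,
  ≤-antisym o≤p (+-≡⇒≤-swap eq m≤n)

leastWitness : ∀ {p} {P : ℕ → Set p} → (∀ n → Dec (P n)) → ∀ {n} → P n →
               Σ[ r ∈ ℕ ] P r × r ≤ n × (∀ i → i < r → ¬ P i)
leastWitness P? {n} Pn with P? 0
... | yes P0 = 0 , P0 , z≤n , λ _ ()
leastWitness P? {zero}  Pn | no ¬P0 = contradiction Pn ¬P0
leastWitness P? {suc n} Pn | no ¬P0 with leastWitness (P? ∘ suc) Pn
... | r , Pr , r≤n , below = suc r , Pr , s≤s r≤n , below′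
  where
  below′ : ∀ i → i < suc r → ¬ _
  below′ zero    _         = ¬P0
  below′ (suc i) (s≤s i<r) = below i i<r

row : List ℕ → ℕ → ℕ
row []       i       = 0
row (x ∷ xs) zero    = x
row (x ∷ xs) (suc i) = row xs i

part-suc : ∀ xs i → part xs (suc i) ≡ row xs i
part-suc []       i       = refl
part-suc (x ∷ xs) zero    = refl
part-suc (x ∷ xs) (suc i) = part-suc xs i

inDiagram⇒<row : ∀ xs {i j} → InDiagram xs (i , j) → j < row xs i
inDiagram⇒<row (x ∷ xs) {zero}  p = p
inDiagram⇒<row (x ∷ xs) {suc i} p = inDiagram⇒<row xs p

<row⇒inDiagram : ∀ xs {i j} → j < row xs i → InDiagram xs (i , j)
<row⇒inDiagram (x ∷ xs) {zero}  p = p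
<row⇒inDiagram (x ∷ xs) {suc i} p = <row⇒inDiagram xs p

row-suc≤row : ∀ {xs} → Linked _≥_ xs → ∀ i → row xs (suc i) ≤ row xs i
row-suc≤row []      i       = z≤n
row-suc≤row [-]     i       = z≤n
row-suc≤row (p ∷ l) zero    = p
row-suc≤row (p ∷ l) (suc i) = row-suc≤row l i

row-antitone : ∀ {xs} → Linked _≥_ xs → ∀ {i j} → i ≤ j → row xs j ≤ row xs i
row-antitone l {j = zero}  z≤n = ≤-refl
row-antitone l {j = suc j} i≤1+j with m≤n⇒m<n∨m≡n i≤1+j
... | inj₂ refl      = ≤-refl
... | inj₁ (s≤s i≤j) = ≤-trans (row-suc≤row l j) (row-antitone l i≤j)

row-positive : ∀ {xs} → All (1 ≤_) xs → ∀ {i} → i < length xs → 1 ≤ row xs i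
row-positive (p ∷ a) {zero}  _         = p
row-positive (p ∷ a) {suc i} (s≤s i<n) = row-positive a i<n

row-beyondLength : ∀ xs {i} → length xs ≤ i → row xs i ≡ 0
row-beyondLength []       _         = refl
row-beyondLength (x ∷ xs) (s≤s n≤i) = row-beyondLength xs n≤i

row-positive⇒<length : ∀ xs {i} → 1 ≤ row xs i → i < length xs
row-positive⇒<length (x ∷ xs) {zero}  _ = s≤s z≤n
row-positive⇒<length (x ∷ xs) {suc i} p = s≤s (row-positive⇒<length xs p)

≡-byRows : ∀ {xs ys} → All (1 ≤_) xs → All (1 ≤_) ys → (∀ i → row xs i ≡ row ys i) → xs ≡ ys
≡-byRows []      []      _  = refl
≡-byRows []      (q ∷ b) eq = contradiction (subst (1 ≤_) (sym (eq 0)) q) λ ()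
≡-byRows (p ∷ a) []      eq = contradiction (subst (1 ≤_) (eq 0) p) λ ()
≡-byRows (p ∷ a) (q ∷ b) eq = cong₂ _∷_ (eq 0) (≡-byRows a b (eq ∘ suc))

linked-byRows : ∀ xs → (∀ i → row xs (suc i) ≤ row xs i) → Linked _≥_ xs
linked-byRows []           _   = []
linked-byRows (x ∷ [])     _   = [-]
linked-byRows (x ∷ y ∷ xs) dec = dec 0 ∷ linked-byRows (y ∷ xs) (dec ∘ suc)

conjPart-accept : ∀ {x xs j} → j ≤ x → conjPart (x ∷ xs) j ≡ suc (conjPart xs j)
conjPart-accept {j = j} j≤x = cong length (filter-accept (j ≤?_) j≤x)

conjPart-reject : ∀ {x xs j} → ¬ j ≤ x → conjPart (x ∷ xs) j ≡ conjPart xs j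
conjPart-reject {j = j} j≰x = cong length (filter-reject (j ≤?_) j≰x)

conjPart≤length : ∀ xs j → conjPart xs j ≤ length xs
conjPart≤length xs j = length-filter (j ≤?_) xs

<row⇒<conjPart : ∀ {xs} → Linked _≥_ xs → ∀ {i j} → j < row xs i → i < conjPart xs (suc j)
<row⇒<conjPart {x ∷ xs} l {i} {j} j<row with suc j ≤? x
... | no  j≮x = contradiction (≤-trans j<row (row-antitone l {0} {i} z≤n)) j≮x
... | yes j<x with i
...   | zero  = subst (0 <_) (sym (conjPart-accept j<x)) z<s
...   | suc i = subst (suc i <_) (sym (conjPart-accept j<x)) (s≤s (<row⇒<conjPart (Linked.tail l) j<row))

<conjPart⇒<row : ∀ {xs} → Linked _≥_ xs → ∀ {i j} → i < conjPart xs (suc j) → j < row xs i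
<conjPart⇒<row {x ∷ xs} l {i} {j} i<col with suc j ≤? x
... | no  j≮x = contradiction (≤-trans j<row (row-antitone l {0} {suc i} z≤n)) j≮x
  where j<row = <conjPart⇒<row (Linked.tail l) (subst (i <_) (conjPart-reject j≮x) i<col)
... | yes j<x with i | subst (i <_) (conjPart-accept j<x) i<col
...   | zero  | _          = j<x
...   | suc i | s≤s i<col′ = <conjPart⇒<row (Linked.tail l) i<col′

sumFrom : (ℕ → ℕ) → ℕ → ℕ → ℕ
sumFrom g a zero    = 0
sumFrom g a (suc n) = g a + sumFrom g (suc a) n

InRange : ℕ → ℕ → ℕ → Set
InRange a n i = a ≤ i × i < a + n

private
  inRange-head : ∀ a n → InRange a (suc n) a
  inRange-head a n = ≤-refl , m<m+n a z<s

  inRange-tail : ∀ {a n i} → InRange (suc a) n i → InRange a (suc n) i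
  inRange-tail {a} {n} {i} (a<i , i<) = <⇒≤ a<i , subst (i <_) (sym (+-suc a n)) i<

sumFrom-cong : ∀ {g g′} a n → (∀ i → InRange a n i → g i ≡ g′ i) → sumFrom g a n ≡ sumFrom g′ a n
sumFrom-cong a zero    eq = refl
sumFrom-cong a (suc n) eq =
  cong₂ _+_ (eq a (inRange-head a n)) (sumFrom-cong (suc a) n (λ i → eq i ∘ inRange-tail))

sumFrom-mono : ∀ {g g′} a n → (∀ i → InRange a n i → g i ≤ g′ i) → sumFrom g a n ≤ sumFrom g′ a n
sumFrom-mono a zero    le = z≤n
sumFrom-mono a (suc n) le =
  +-mono-≤ (le a (inRange-head a n)) (sumFrom-mono (suc a) n (λ i → le i ∘ inRange-tail))

sumFrom-zeros : ∀ {g} a n → (∀ i → InRange a n i → g i ≡ 0) → sumFrom g a n ≡ 0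
sumFrom-zeros a zero    zeros = refl
sumFrom-zeros a (suc n) zeros =
  cong₂ _+_ (zeros a (inRange-head a n)) (sumFrom-zeros (suc a) n (λ i → zeros i ∘ inRange-tail))

sumFrom-ones : ∀ {g} a n → (∀ i → InRange a n i → g i ≡ 1) → sumFrom g a n ≡ n
sumFrom-ones a zero    ones = refl
sumFrom-ones a (suc n) ones =
  cong₂ _+_ (ones a (inRange-head a n)) (sumFrom-ones (suc a) n (λ i → ones i ∘ inRange-tail))

sumFrom≡0⇒zeros : ∀ {g} a n → sumFrom g a n ≡ 0 → ∀ i → InRange a n i → g i ≡ 0
sumFrom≡0⇒zeros     a zero    _     i (a≤i , i<) = contradiction (subst (i <_) (+-identityʳ a) i<) (≤⇒≯ a≤i)
sumFrom≡0⇒zeros {g} a (suc n) sum≡0 i (a≤i , i<) with m≤n⇒m<n∨m≡n a≤i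
... | inj₂ refl = m+n≡0⇒m≡0 (g a) sum≡0
... | inj₁ a<i  = sumFrom≡0⇒zeros (suc a) n (m+n≡0⇒n≡0 (g a) sum≡0) i (a<i , subst (i <_) (+-suc a n) i<)

sumFrom-+ : ∀ g g′ a n → sumFrom (λ i → g i + g′ i) a n ≡ sumFrom g a n + sumFrom g′ a n
sumFrom-+ g g′ a zero    = refl
sumFrom-+ g g′ a (suc n) = trans (cong (g a + g′ a +_) (sumFrom-+ g g′ (suc a) n)) (+-+-interchange (g a) (g′ a) _ _)
  where
  +-+-interchange : ∀ w x y z → w + x + (y + z) ≡ w + y + (x + z)
  +-+-interchange = solve-∀

sumFrom-split : ∀ g a n m → sumFrom g a (n + m) ≡ sumFrom g a n + sumFrom g (a + n) m
sumFrom-split g a zero    m = cong (λ b → sumFrom g b m) (sym (+-identityʳ a))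
sumFrom-split g a (suc n) m = begin
  g a + sumFrom g (suc a) (n + m)                        ≡⟨ cong (g a +_) (sumFrom-split g (suc a) n m) ⟩
  g a + (sumFrom g (suc a) n + sumFrom g (suc a + n) m)  ≡⟨ cong (λ b → g a + (front + sumFrom g b m)) (+-suc a n) ⟨
  g a + (sumFrom g (suc a) n + sumFrom g (a + suc n) m)  ≡⟨ +-assoc (g a) _ _ ⟨
  g a + sumFrom g (suc a) n + sumFrom g (a + suc n) m    ∎
  where
  open ≡-Reasoning
  front = sumFrom g (suc a) n

sumFrom-shift : ∀ g a n → sumFrom (g ∘ suc) a n ≡ sumFrom g (suc a) n
sumFrom-shift g a zero    = refl
sumFrom-shift g a (suc n) = cong (g (suc a) +_) (sumFrom-shift g (suc a) n)

sumFrom-prefix : ∀ g {s d} → s ≤ d → sumFrom g 0 d ≡ sumFrom g 0 s + sumFrom g s (d ∸ s)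
sumFrom-prefix g {s} {d} s≤d = trans (cong (sumFrom g 0) (sym (m+[n∸m]≡n s≤d))) (sumFrom-split g 0 s (d ∸ s))

sumFrom-zerosBeyond : ∀ {g s d} → s ≤ d → (∀ i → s ≤ i → i < d → g i ≡ 0) → sumFrom g 0 d ≡ sumFrom g 0 s
sumFrom-zerosBeyond {g} {s} {d} s≤d zeros = begin
  sumFrom g 0 d                        ≡⟨ sumFrom-prefix g s≤d ⟩
  sumFrom g 0 s + sumFrom g s (d ∸ s)  ≡⟨ cong (sumFrom g 0 s +_) (sumFrom-zeros s (d ∸ s) zeros′) ⟩
  sumFrom g 0 s + 0                    ≡⟨ +-identityʳ _ ⟩
  sumFrom g 0 s                        ∎
  where
  open ≡-Reasoning
  zeros′ : ∀ i → InRange s (d ∸ s) i → g i ≡ 0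
  zeros′ i (s≤i , i<) = zeros i s≤i (subst (i <_) (m+[n∸m]≡n s≤d) i<)

𝟙 : ∀ {p} {P : Set p} → Dec P → ℕ
𝟙 (yes _) = 1
𝟙 (no _)  = 0

module _ {p} {P : Set p} where

  𝟙≤1 : (P? : Dec P) → 𝟙 P? ≤ 1
  𝟙≤1 (yes _) = s≤s z≤n
  𝟙≤1 (no _)  = z≤n

  𝟙-yes : (P? : Dec P) → P → 𝟙 P? ≡ 1
  𝟙-yes (yes _) _ = refl
  𝟙-yes (no ¬p) p = contradiction p ¬p

  𝟙-no : (P? : Dec P) → ¬ P → 𝟙 P? ≡ 0
  𝟙-no (yes p) ¬p = contradiction p ¬p
  𝟙-no (no _)  _  = refl

  𝟙≡0⇒¬ : (P? : Dec P) → 𝟙 P? ≡ 0 → ¬ P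
  𝟙≡0⇒¬ (no ¬p) _ = ¬p

  𝟙≡1⇒ : (P? : Dec P) → 𝟙 P? ≡ 1 → P
  𝟙≡1⇒ (yes p) _ = p

𝟙-mono : ∀ {p q} {P : Set p} {Q : Set q} (P? : Dec P) (Q? : Dec Q) → (P → Q) → 𝟙 P? ≤ 𝟙 Q?
𝟙-mono (yes p) Q? P⇒Q = ≤-reflexive (sym (𝟙-yes Q? (P⇒Q p)))
𝟙-mono (no _)  _  _   = z≤n

𝟙-cong : ∀ {p q} {P : Set p} {Q : Set q} (P? : Dec P) (Q? : Dec Q) → (P → Q) → (Q → P) → 𝟙 P? ≡ 𝟙 Q?
𝟙-cong P? Q? P⇒Q Q⇒P = ≤-antisym (𝟙-mono P? Q? P⇒Q) (𝟙-mono Q? P? Q⇒P)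

module _ {p} {T : ℕ → Set p} (T? : ∀ i → Dec (T i)) where

  count : ℕ → ℕ
  count d = sumFrom (𝟙 ∘ T?) 0 d

  count-≥ : ∀ {s d} → s ≤ d → (∀ i → i < s → T i) → s ≤ count d
  count-≥ {s} {d} s≤d prefix = begin
    s                                                    ≡⟨ sumFrom-ones 0 s ones ⟨
    sumFrom (𝟙 ∘ T?) 0 s                                 ≤⟨ m≤m+n _ _ ⟩
    sumFrom (𝟙 ∘ T?) 0 s + sumFrom (𝟙 ∘ T?) s (d ∸ s)   ≡⟨ sumFrom-prefix (𝟙 ∘ T?) s≤d ⟨
    count d                                              ∎
    where
    open ≤-Reasoning
    ones : ∀ i → InRange 0 s i → 𝟙 (T? i) ≡ 1
    ones i (_ , i<s) = 𝟙-yes (T? i) (prefix i i<s)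

  count-≤ : ∀ {s d} → s ≤ d → (∀ i → s ≤ i → i < d → ¬ T i) → count d ≤ s
  count-≤ {s} {d} s≤d suffix = begin
    count d                ≡⟨ sumFrom-zerosBeyond s≤d (λ i s≤i i<d → 𝟙-no (T? i) (suffix i s≤i i<d)) ⟩
    sumFrom (𝟙 ∘ T?) 0 s   ≤⟨ sumFrom-mono 0 s (λ i _ → 𝟙≤1 (T? i)) ⟩
    sumFrom (λ _ → 1) 0 s  ≡⟨ sumFrom-ones 0 s (λ _ _ → refl) ⟩
    s                      ∎
    where open ≤-Reasoning

count-interval : ∀ {a b n} → a ≤ b → b ≤ n → count (λ i → (a ≤? i) ×-dec (i <? b)) n ≡ b ∸ a
count-interval {a} {b} {n} a≤b b≤n = begin
  sumFrom g 0 n                        ≡⟨ sumFrom-zerosBeyond b≤n beyond ⟩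
  sumFrom g 0 b                        ≡⟨ sumFrom-prefix g a≤b ⟩
  sumFrom g 0 a + sumFrom g a (b ∸ a)  ≡⟨ cong₂ _+_ (sumFrom-zeros 0 a below) (sumFrom-ones a (b ∸ a) inside) ⟩
  b ∸ a                                ∎
  where
  open ≡-Reasoning
  a≤?i<?b = λ i → (a ≤? i) ×-dec (i <? b)
  g = 𝟙 ∘ a≤?i<?b
  beyond : ∀ i → b ≤ i → i < n → g i ≡ 0
  beyond i b≤i _ = 𝟙-no (a≤?i<?b i) λ (_ , i<b) → <⇒≱ i<b b≤i
  below : ∀ i → InRange 0 a i → g i ≡ 0
  below i (_ , i<a) = 𝟙-no (a≤?i<?b i) λ (a≤i , _) → <⇒≱ i<a a≤i
  inside : ∀ i → InRange a (b ∸ a) i → g i ≡ 1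
  inside i (a≤i , i<) = 𝟙-yes (a≤?i<?b i) (a≤i , subst (i <_) (m+[n∸m]≡n a≤b) i<)

-- Removing the rim hook of a first-column cell

-- Correct on partitions only: it stops at the first part ≤ 1, all later parts being 1 too.
dropFirstColumn : List ℕ → List ℕ
dropFirstColumn []                 = []
dropFirstColumn (zero ∷ xs)        = []
dropFirstColumn (suc zero ∷ xs)    = []
dropFirstColumn (suc (suc n) ∷ xs) = suc n ∷ dropFirstColumn xs

-- ν minus the rim hook of the cell (r , 0): the rows below row r move up by one and lose
-- their first cell.
removeHook : List ℕ → ℕ → List ℕ
removeHook []       r       = []
removeHook (x ∷ ν)  zero    = dropFirstColumn ν
removeHook (x ∷ ν)  (suc r) = x ∷ removeHook ν r

hookLength : List ℕ → ℕ → ℕ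
hookLength ν r = row ν r + (length ν ∸ suc r)

row-dropFirstColumn : ∀ {xs} → IsPartition xs → ∀ i → row (dropFirstColumn xs) i ≡ row xs i ∸ 1
row-dropFirstColumn {[]}               _           i       = refl
row-dropFirstColumn {zero ∷ xs}        (_ , () ∷ _)
row-dropFirstColumn {suc zero ∷ xs}    _           zero    = refl
row-dropFirstColumn {suc zero ∷ xs}    (l , _)     (suc i) with row xs i | row-antitone l {0} {suc i} z≤n
... | zero  | _       = refl
... | suc _ | s≤s z≤n = refl
row-dropFirstColumn {suc (suc n) ∷ xs} _           zero    = refl
row-dropFirstColumn {suc (suc n) ∷ xs} (l , _ ∷ a) (suc i) = row-dropFirstColumn (Linked.tail l , a) i

row-removeHook-< : ∀ ν {r i} → i < r → row (removeHook ν r) i ≡ row ν i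
row-removeHook-< []      _                     = refl
row-removeHook-< (x ∷ ν) {i = zero}  (s≤s _)   = refl
row-removeHook-< (x ∷ ν) {i = suc i} (s≤s i<r) = row-removeHook-< ν i<r

row-removeHook-≥ : ∀ {ν} → IsPartition ν → ∀ {r i} → r ≤ i →
                   row (removeHook ν r) i ≡ row ν (suc i) ∸ 1
row-removeHook-≥ {[]}    _                           _         = refl
row-removeHook-≥ {x ∷ ν} (l , _ ∷ a) {zero}          _         = row-dropFirstColumn (Linked.tail l , a) _
row-removeHook-≥ {x ∷ ν} (l , _ ∷ a) {suc r} {suc i} (s≤s r≤i) = row-removeHook-≥ (Linked.tail l , a) r≤i

row-removeHook-≤ : ∀ {ν} → IsPartition ν → ∀ r i → row (removeHook ν r) i ≤ row ν i
row-removeHook-≤ {ν} P r i with i <? r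
... | yes i<r = ≤-reflexive (row-removeHook-< ν i<r)
... | no  i≮r = begin
  row (removeHook ν r) i  ≡⟨ row-removeHook-≥ P (≮⇒≥ i≮r) ⟩
  row ν (suc i) ∸ 1       ≤⟨ m∸n≤m _ 1 ⟩
  row ν (suc i)           ≤⟨ row-suc≤row (proj₁ P) i ⟩
  row ν i                 ∎
  where open ≤-Reasoning

row-removeHook-suc≤ : ∀ {ν} → IsPartition ν → ∀ r i →
                      row (removeHook ν r) (suc i) ≤ row (removeHook ν r) i
row-removeHook-suc≤ {ν} P r i with i <? r
... | yes i<r = begin
  row (removeHook ν r) (suc i)  ≤⟨ row-removeHook-≤ P r (suc i) ⟩
  row ν (suc i)                 ≤⟨ row-suc≤row (proj₁ P) i ⟩
  row ν i                       ≡⟨ row-removeHook-< ν i<r ⟨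
  row (removeHook ν r) i        ∎
  where open ≤-Reasoning
... | no  i≮r = begin
  row (removeHook ν r) (suc i)  ≡⟨ row-removeHook-≥ P (m≤n⇒m≤1+n (≮⇒≥ i≮r)) ⟩
  row ν (suc (suc i)) ∸ 1       ≤⟨ ∸-monoˡ-≤ 1 (row-suc≤row (proj₁ P) (suc i)) ⟩
  row ν (suc i) ∸ 1             ≡⟨ row-removeHook-≥ P (≮⇒≥ i≮r) ⟨
  row (removeHook ν r) i        ∎
  where open ≤-Reasoning

dropFirstColumn-positive : ∀ xs → All (1 ≤_) (dropFirstColumn xs)
dropFirstColumn-positive []                 = []
dropFirstColumn-positive (zero ∷ xs)        = []
dropFirstColumn-positive (suc zero ∷ xs)    = []
dropFirstColumn-positive (suc (suc n) ∷ xs) = s≤s z≤n ∷ dropFirstColumn-positive xs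

removeHook-positive : ∀ {ν} → All (1 ≤_) ν → ∀ r → All (1 ≤_) (removeHook ν r)
removeHook-positive {[]}    _       r       = []
removeHook-positive {x ∷ ν} _       zero    = dropFirstColumn-positive ν
removeHook-positive {x ∷ ν} (p ∷ a) (suc r) = p ∷ removeHook-positive a r

removeHook-isPartition : ∀ {ν} → IsPartition ν → ∀ r → IsPartition (removeHook ν r)
removeHook-isPartition {ν} P r =
  linked-byRows (removeHook ν r) (row-removeHook-suc≤ P r) , removeHook-positive (proj₂ P) r

length-dropFirstColumn : ∀ xs → length (dropFirstColumn xs) ≤ length xs
length-dropFirstColumn []                 = z≤n
length-dropFirstColumn (zero ∷ xs)        = z≤n
length-dropFirstColumn (suc zero ∷ xs)    = z≤n
length-dropFirstColumn (suc (suc n) ∷ xs) = s≤s (length-dropFirstColumn xs)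

length-removeHook : ∀ ν {r} → r < length ν → length (removeHook ν r) < length ν
length-removeHook (x ∷ ν) {zero}  _         = s≤s (length-dropFirstColumn ν)
length-removeHook (x ∷ ν) {suc r} (s≤s r<n) = s≤s (length-removeHook ν r<n)

sum-dropFirstColumn : ∀ {xs} → IsPartition xs → sum xs ≡ sum (dropFirstColumn xs) + length xs
sum-dropFirstColumn {[]}               _           = refl
sum-dropFirstColumn {suc zero ∷ xs}    (l , _ ∷ a) = cong suc (sum-ones l a)
  where
  sum-ones : ∀ {ys} → Linked _≥_ (1 ∷ ys) → All (1 ≤_) ys → sum ys ≡ length ys
  sum-ones {[]}     _             _             = refl
  sum-ones {y ∷ ys} (s≤s z≤n ∷ l) (s≤s z≤n ∷ a) = cong suc (sum-ones l a)
sum-dropFirstColumn {suc (suc n) ∷ xs} (l , _ ∷ a) = begin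
  suc (suc n + sum xs)                                  ≡⟨ cong (λ s → suc (suc n + s)) sum-xs ⟩
  suc (suc n + (sum (dropFirstColumn xs) + length xs))  ≡⟨ shuffle n (sum (dropFirstColumn xs)) (length xs) ⟩
  suc n + sum (dropFirstColumn xs) + suc (length xs)    ∎
  where
  open ≡-Reasoning
  sum-xs = sum-dropFirstColumn (Linked.tail l , a)
  shuffle : ∀ a b c → suc (suc a + (b + c)) ≡ suc a + b + suc c
  shuffle = solve-∀

sum-removeHook : ∀ {ν} → IsPartition ν → ∀ {r} → r < length ν →
                 sum ν ≡ sum (removeHook ν r) + hookLength ν r
sum-removeHook {x ∷ ν} (l , _ ∷ a) {zero}  _ = begin
  x + sum ν                                 ≡⟨ cong (x +_) (sum-dropFirstColumn (Linked.tail l , a)) ⟩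
  x + (sum (dropFirstColumn ν) + length ν)  ≡⟨ shuffle x (sum (dropFirstColumn ν)) (length ν) ⟩
  sum (dropFirstColumn ν) + (x + length ν)  ∎
  where
  open ≡-Reasoning
  shuffle : ∀ a b c → a + (b + c) ≡ b + (a + c)
  shuffle = solve-∀
sum-removeHook {x ∷ ν} (l , _ ∷ a) {suc r} (s≤s r<n) =
  trans (cong (x +_) (sum-removeHook (Linked.tail l , a) r<n)) (sym (+-assoc x _ _))

skewSize-removeHook : ∀ {ν} → IsPartition ν → ∀ {r} → r < length ν →
                      skewSize ν (removeHook ν r) ≡ hookLength ν r
skewSize-removeHook {ν} P {r} r<ν =
  trans (cong (_∸ sum (removeHook ν r)) (sum-removeHook P r<ν)) (m+n∸m≡n (sum (removeHook ν r)) _)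

-- Ribbons meeting the first column

inSkew⇒ : ∀ ν ρ {i j} → InSkew ν ρ (i , j) → row ρ i ≤ j × j < row ν i
inSkew⇒ ν ρ (in-ν , ∉ρ) = ≮⇒≥ (∉ρ ∘ <row⇒inDiagram ρ) , inDiagram⇒<row ν in-ν

⇒inSkew : ∀ ν ρ {i j} → row ρ i ≤ j → j < row ν i → InSkew ν ρ (i , j)
⇒inSkew ν ρ ρ≤j j<ν = <row⇒inDiagram ν j<ν , λ in-ρ → ≤⇒≯ ρ≤j (inDiagram⇒<row ρ in-ρ)

adj-sym : ∀ {a b} → Adj a b → Adj b a
adj-sym right = left
adj-sym left  = right
adj-sym down  = up
adj-sym up    = down

module _ {S : Cell → Set} where

  reach-++ : ∀ {a b c} → Reach S a b → Reach S b c → Reach S a c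
  reach-++ here           q = q
  reach-++ (step ab sb p) q = step ab sb (reach-++ p q)

  reach-snoc : ∀ {a b c} → Reach S a b → Adj b c → S c → Reach S a c
  reach-snoc here           bc sc = step bc sc here
  reach-snoc (step ab sb p) bc sc = step ab sb (reach-snoc p bc sc)

  reach-sym : ∀ {a b} → S a → Reach S a b → Reach S b a
  reach-sym sa here           = here
  reach-sym sa (step ab sb p) = reach-snoc (reach-sym sb p) (adj-sym ab) sa

  reach-left : ∀ {i c} t → (∀ u → u ≤ t → S (i , u + c)) → Reach S (i , t + c) (i , c)
  reach-left zero    inS = here
  reach-left (suc t) inS = step left (inS t (n≤1+n t)) (reach-left t (λ u u≤t → inS u (m≤n⇒m≤1+n u≤t)))

  reach-crossesRow : ∀ {a b} i → S a → Reach S a b → proj₁ a ≤ i → i < proj₁ b →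
                     Σ[ c ∈ ℕ ] S (i , c) × S (suc i , c)
  reach-crossesRow i sa here                    a≤i i<b = contradiction a≤i (<⇒≱ i<b)
  reach-crossesRow i sa (step right sb p)       a≤i i<b = reach-crossesRow i sb p a≤i i<b
  reach-crossesRow i sa (step left sb p)        a≤i i<b = reach-crossesRow i sb p a≤i i<b
  reach-crossesRow i sa (step up sb p)          a≤i i<b = reach-crossesRow i sb p (≤-trans (n≤1+n _) a≤i) i<b
  reach-crossesRow i sa (step (down {i′}) sb p) a≤i i<b with i′ ≟ i
  ... | yes refl = _ , sa , sb
  ... | no  i′≢i = reach-crossesRow i sb p (≤∧≢⇒< a≤i i′≢i) i<b

module HookRibbon {x xs} (P : IsPartition (x ∷ xs)) {r} (r≤z : r ≤ length xs) where

  private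
    ν = x ∷ xs
    ρ = removeHook ν r
    z = length xs
    S = InSkew ν ρ

    s⇒ : ∀ {i j} → S (i , j) → row ρ i ≤ j × j < row ν i
    s⇒ = inSkew⇒ ν ρ

    ⇒s : ∀ {i j} → row ρ i ≤ j → j < row ν i → S (i , j)
    ⇒s = ⇒inSkew ν ρ

  row-removeHook-last : row ρ z ≡ 0
  row-removeHook-last = trans (row-removeHook-≥ P r≤z) (cong (_∸ 1) (row-beyondLength ν ≤-refl))

  inSkew⇒r≤ : ∀ {i j} → S (i , j) → r ≤ i
  inSkew⇒r≤ {i} {j} s with i <? r
  ... | no  i≮r = ≮⇒≥ i≮r
  ... | yes i<r = contradiction (subst (j <_) (sym (row-removeHook-< ν i<r)) j<ν) (≤⇒≯ ρ≤j)
    where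
    ρ≤j = proj₁ (s⇒ s)
    j<ν = proj₂ (s⇒ s)

  reach-rowStart : ∀ {i j} → S (i , j) → Reach S (i , j) (i , row ρ i)
  reach-rowStart {i} {j} s = subst (λ w → Reach S (i , w) (i , row ρ i)) (m∸n+n≡m ρ≤j)
    (reach-left (j ∸ row ρ i) λ u u≤ → ⇒s (m≤n+m _ u)
      (≤-<-trans (≤-trans (+-monoˡ-≤ (row ρ i) u≤) (≤-reflexive (m∸n+n≡m ρ≤j))) j<ν))
    where
    ρ≤j = proj₁ (s⇒ s)
    j<ν = proj₂ (s⇒ s)

  inSkew-below-rowStart : ∀ {i j} → S (i , j) → suc i ≤ z → S (suc i , row ρ i)
  inSkew-below-rowStart {i} s i<z = ⇒s
    (begin
      row ρ (suc i)            ≡⟨ row-removeHook-≥ P (m≤n⇒m≤1+n r≤i) ⟩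
      row ν (suc (suc i)) ∸ 1  ≤⟨ ∸-monoˡ-≤ 1 (row-suc≤row (proj₁ P) (suc i)) ⟩
      row ν (suc i) ∸ 1        ≡⟨ ρi ⟨
      row ρ i                  ∎)
    (subst (_< row ν (suc i)) (sym ρi) (∸-monoʳ-< {o = 0} z<s (row-positive (proj₂ P) (s≤s i<z))))
    where
    open ≤-Reasoning
    r≤i = inSkew⇒r≤ s
    ρi = row-removeHook-≥ P r≤i

  reach-lastRow : ∀ n {i j} → n + i ≡ z → S (i , j) → Reach S (i , j) (z , 0)
  reach-lastRow zero    refl      s = subst (λ w → Reach S (z , _) (z , w)) row-removeHook-last (reach-rowStart s)
  reach-lastRow (suc n) {i} n+i≡z s =
    reach-++ (reach-rowStart s) (step down below (reach-lastRow n (trans (+-suc n i) n+i≡z) below))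
    where
    below = inSkew-below-rowStart s (subst (suc i ≤_) n+i≡z (s≤s (m≤n+m i n)))

  connected : Connected S
  connected a b sa sb = reach-++ (toLast sa) (reach-sym sb (toLast sb))
    where
    toLast : ∀ {c} → S c → Reach S c (z , 0)
    toLast {i , j} s = reach-lastRow (z ∸ i) (m∸n+n≡m (≤-pred i<ν)) s
      where
      i<ν : i < length ν
      i<ν = row-positive⇒<length ν (≤-<-trans z≤n (proj₂ (s⇒ s)))

  no2x2 : No2x2 S
  no2x2 i j (s , _ , _ , s′) = <⇒≱ j<ρi (proj₁ (s⇒ s))
    where
    j<ρi : j < row ρ i
    j<ρi = subst (j <_) (sym (row-removeHook-≥ P (inSkew⇒r≤ s))) (∸-monoˡ-≤ 1 (proj₂ (s⇒ s′)))

  isRibbon : IsRibbon ν ρ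
  isRibbon = ρ⊆ν , connected , no2x2
    where
    ρ⊆ν : ρ ⊆ᵈ ν
    ρ⊆ν (i , j) in-ρ =
      <row⇒inDiagram ν {i} (<-≤-trans (inDiagram⇒<row ρ in-ρ) (row-removeHook-≤ P r i))

  lastRowCell : InSkew ν ρ (z , 0)
  lastRowCell = ⇒s (≤-reflexive row-removeHook-last) (row-positive (proj₂ P) ≤-refl)

⊆ᵈ⇒row≤ : ∀ {ν ρ} → ρ ⊆ᵈ ν → ∀ i → row ρ i ≤ row ν i
⊆ᵈ⇒row≤ {ν} {ρ} ρ⊆ν i with row ρ i in eq
... | zero  = z≤n
... | suc c = inDiagram⇒<row ν (ρ⊆ν (i , c) (<row⇒inDiagram ρ {i} (subst (c <_) (sym eq) ≤-refl)))

no2x2⇒row-suc∸1≤row : ∀ {ν ρ} → Linked _≥_ ν → Linked _≥_ ρ → No2x2 (InSkew ν ρ) →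
                       ∀ i → row ν (suc i) ∸ 1 ≤ row ρ i
no2x2⇒row-suc∸1≤row {ν} {ρ} lν lρ no2x2 i with suc (suc (row ρ i)) ≤? row ν (suc i)
... | no  c+2≰ν = ∸-monoˡ-≤ 1 (≤-pred (≰⇒> c+2≰ν))
... | yes c+2≤ν = contradiction
        ( ⇒inSkew ν ρ ≤-refl                      (≤-trans (≤-trans (n≤1+n _) c+2≤ν) νi+1≤νi)
        , ⇒inSkew ν ρ (n≤1+n _)                   (≤-trans c+2≤ν νi+1≤νi)
        , ⇒inSkew ν ρ ρi+1≤c                      (≤-trans (n≤1+n _) c+2≤ν)
        , ⇒inSkew ν ρ (≤-trans ρi+1≤c (n≤1+n _)) c+2≤ν )
        (no2x2 i (row ρ i))
  where
  νi+1≤νi = row-suc≤row lν i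
  ρi+1≤c  = row-suc≤row lρ i

firstColumnRibbon⇒removeHook : ∀ {ν ρ} → IsPartition ν → IsPartition ρ → IsRibbon ν ρ →
                               ∀ {i₀} → InSkew ν ρ (i₀ , 0) →
                               Σ[ r ∈ ℕ ] r < length ν × ρ ≡ removeHook ν r
firstColumnRibbon⇒removeHook {[]}    _  _  _ (() , _)
firstColumnRibbon⇒removeHook {x ∷ xs} {ρ} Pν Pρ (ρ⊆ν , connected , no2x2) {i₀} cell =
  r , ≤-<-trans r≤i₀ i₀<ν , ≡-byRows (proj₂ Pρ) (removeHook-positive (proj₂ Pν) r) sameRows
  where
  ν = x ∷ xs
  z = length xs
  S = InSkew ν ρ

  i₀<ν : i₀ < length ν
  i₀<ν = row-positive⇒<length ν (proj₂ (inSkew⇒ ν ρ cell))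

  ρ-vanishes : ∀ {i} → i₀ ≤ i → row ρ i ≡ 0
  ρ-vanishes i₀≤i = n≤0⇒n≡0 (≤-trans (row-antitone (proj₁ Pρ) i₀≤i) (proj₁ (inSkew⇒ ν ρ cell)))

  first = leastWitness (λ i → row ρ i <? row ν i) {i₀} (uncurry ≤-<-trans (inSkew⇒ ν ρ cell))
  r = proj₁ first
  ρr<νr = proj₁ (proj₂ first)
  r≤i₀  = proj₁ (proj₂ (proj₂ first))

  above : ∀ {i} → i < r → row ρ i ≡ row ν i
  above {i} i<r = ≤-antisym (⊆ᵈ⇒row≤ {ν} {ρ} ρ⊆ν i) (≮⇒≥ (proj₂ (proj₂ (proj₂ first)) i i<r))

  firstCell : S (r , row ρ r)
  firstCell = ⇒inSkew ν ρ ≤-refl ρr<νr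

  lastCell : S (z , 0)
  lastCell = ⇒inSkew ν ρ (≤-reflexive (ρ-vanishes (≤-pred i₀<ν))) (row-positive (proj₂ Pν) ≤-refl)

  -- The ribbon is connected, so it crosses from each row i ≥ r to the next one.
  ρ<ν-below : ∀ {i} → r ≤ i → i < z → row ρ i < row ν (suc i)
  ρ<ν-below {i} r≤i i<z with reach-crossesRow i firstCell (connected _ _ firstCell lastCell) r≤i i<z
  ... | c , sic , si+1c = ≤-<-trans (proj₁ (inSkew⇒ ν ρ sic)) (proj₂ (inSkew⇒ ν ρ si+1c))

  below : ∀ {i} → r ≤ i → row ρ i ≡ row ν (suc i) ∸ 1
  below {i} r≤i with i <? z
  ... | yes i<z = ≤-antisym (∸-monoˡ-≤ 1 (ρ<ν-below r≤i i<z))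
                            (no2x2⇒row-suc∸1≤row (proj₁ Pν) (proj₁ Pρ) no2x2 i)
  ... | no  i≮z = trans (ρ-vanishes (≤-trans (≤-pred i₀<ν) (≮⇒≥ i≮z)))
                        (sym (cong (_∸ 1) (row-beyondLength ν (s≤s (≮⇒≥ i≮z)))))

  sameRows : ∀ i → row ρ i ≡ row (removeHook ν r) i
  sameRows i with i <? r
  ... | yes i<r = trans (above i<r) (sym (row-removeHook-< ν i<r))
  ... | no  i≮r = trans (below (≮⇒≥ i≮r)) (sym (row-removeHook-≥ Pν (≮⇒≥ i≮r)))

-- The abacus

module Abacus (N : ℕ) where

  β : List ℕ → ℕ → ℕ
  β ν i = row ν i + (N ∸ suc i)

  ∑β : (ℕ → ℕ) → List ℕ → ℕ
  ∑β g ν = sumFrom (g ∘ β ν) 0 N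

  module _ {ν} (P : IsPartition ν) (ν≤N : length ν ≤ N) {r} (r<ν : r < length ν) where

    private
      ρ = removeHook ν r
      L = length ν

    β-removeHook-< : ∀ {i} → i < r → β ρ i ≡ β ν i
    β-removeHook-< i<r = cong (_+ (N ∸ suc _)) (row-removeHook-< ν i<r)

    β-removeHook-mid : ∀ {i} → r ≤ i → suc i < L → β ρ i ≡ β ν (suc i)
    β-removeHook-mid {i} r≤i i+1<L = begin
      row ρ i + (N ∸ suc i)                        ≡⟨ cong₂ _+_ (row-removeHook-≥ P r≤i) N∸[1+i]≡1+[N∸[2+i]] ⟩
      row ν (suc i) ∸ 1 + suc (N ∸ suc (suc i))    ≡⟨ +-suc _ _ ⟩
      suc (row ν (suc i) ∸ 1) + (N ∸ suc (suc i))  ≡⟨ cong (_+ (N ∸ suc (suc i))) (suc[n∸1]≡n ν[1+i]≥1) ⟩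
      row ν (suc i) + (N ∸ suc (suc i))            ∎
      where
      open ≡-Reasoning
      N∸[1+i]≡1+[N∸[2+i]] = sym (suc[m∸1+n]≡m∸n (≤-trans i+1<L ν≤N))
      ν[1+i]≥1 = row-positive (proj₂ P) i+1<L

    β-removeHook-last : ∀ {i} → suc i ≡ L → β ρ i ≡ N ∸ L
    β-removeHook-last {i} i+1≡L = begin
      row ρ i + (N ∸ suc i)            ≡⟨ cong (_+ (N ∸ suc i)) (row-removeHook-≥ P r≤i) ⟩
      row ν (suc i) ∸ 1 + (N ∸ suc i)  ≡⟨ cong₂ (λ a b → a ∸ 1 + (N ∸ b)) ν[1+i]≡0 i+1≡L ⟩
      N ∸ L                            ∎
      where
      open ≡-Reasoning
      r≤i = ≤-pred (subst (r <_) (sym i+1≡L) r<ν)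
      ν[1+i]≡0 = row-beyondLength ν (≤-reflexive (sym i+1≡L))

    β-removeHook-beyond : ∀ {i} → L ≤ i → β ρ i ≡ β ν i
    β-removeHook-beyond {i} L≤i = cong (_+ (N ∸ suc i)) (begin
      row ρ i            ≡⟨ row-removeHook-≥ P (≤-trans (<⇒≤ r<ν) L≤i) ⟩
      row ν (suc i) ∸ 1  ≡⟨ cong (_∸ 1) (row-beyondLength ν (m≤n⇒m≤1+n L≤i)) ⟩
      0                  ≡⟨ row-beyondLength ν L≤i ⟨
      row ν i            ∎)
      where open ≡-Reasoning

    -- Removing the hook of (r , 0) moves the bead at β ν r to position N ∸ L.
    ∑β-removeHook : ∀ g → ∑β g ρ + g (β ν r) ≡ ∑β g ν + g (N ∸ L)
    ∑β-removeHook g = begin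
      ∑β g ρ + g x                       ≡⟨ cong (_+ g x) ρ-blocks ⟩
      above + (between + g h) + below + g x  ≡⟨ shuffle above between (g h) below (g x) ⟩
      above + (g x + between) + below + g h  ≡⟨ cong (_+ g h) ν-blocks ⟨
      ∑β g ν + g h                       ∎
      where
      open ≡-Reasoning
      x = β ν r
      h = N ∸ L
      s = L ∸ suc r
      Gρ = g ∘ β ρ
      Gν = g ∘ β ν
      above   = sumFrom Gν 0 r
      between = sumFrom Gν (suc r) s
      below   = sumFrom Gν L h

      r+1+s≡L : r + suc s ≡ L
      r+1+s≡L = trans (+-suc r s) (m+[n∸m]≡n r<ν)

      blocks : ∀ G → sumFrom G 0 N ≡ sumFrom G 0 r + sumFrom G r (suc s) + sumFrom G L h
      blocks G = begin
        sumFrom G 0 N                                        ≡⟨ sumFrom-prefix G ν≤N ⟩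
        sumFrom G 0 L + sumFrom G L h                        ≡⟨ cong (λ n → sumFrom G 0 n + sumFrom G L h) r+1+s≡L ⟨
        sumFrom G 0 (r + suc s) + sumFrom G L h              ≡⟨ cong (_+ sumFrom G L h) (sumFrom-split G 0 r (suc s)) ⟩
        sumFrom G 0 r + sumFrom G r (suc s) + sumFrom G L h  ∎

      ν-blocks : ∑β g ν ≡ above + (g x + between) + below
      ν-blocks = blocks Gν

      ρ-middle : sumFrom Gρ r (suc s) ≡ between + g h
      ρ-middle = begin
        sumFrom Gρ r (suc s)                  ≡⟨ cong (sumFrom Gρ r) (+-comm 1 s) ⟩
        sumFrom Gρ r (s + 1)                  ≡⟨ sumFrom-split Gρ r s 1 ⟩
        sumFrom Gρ r s + (Gρ (r + s) + 0)     ≡⟨ cong₂ (λ a b → a + (b + 0)) shifted (cong g lastRow) ⟩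
        between + (g h + 0)                   ≡⟨ cong (between +_) (+-identityʳ (g h)) ⟩
        between + g h                         ∎
        where
        i+1<L : ∀ {i} → i < r + s → suc i < L
        i+1<L {i} i<r+s = subst (suc i <_) (trans (sym (+-suc r s)) r+1+s≡L) (s≤s i<r+s)
        shifted : sumFrom Gρ r s ≡ between
        shifted = trans (sumFrom-cong r s (λ i (r≤i , i<r+s) → cong g (β-removeHook-mid r≤i (i+1<L i<r+s))))
                        (sumFrom-shift Gν r s)
        lastRow : β ρ (r + s) ≡ h
        lastRow = β-removeHook-last (trans (sym (+-suc r s)) r+1+s≡L)

      ρ-blocks : ∑β g ρ ≡ above + (between + g h) + below
      ρ-blocks = trans (blocks Gρ) (cong₂ _+_ (cong₂ _+_ top ρ-middle) bottom)
        where
        top = sumFrom-cong 0 r (λ i (_ , i<r) → cong g (β-removeHook-< i<r))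
        bottom = sumFrom-cong L h (λ i (L≤i , _) → cong g (β-removeHook-beyond L≤i))

      shuffle : ∀ a b c d e → a + (b + c) + d + e ≡ a + (e + b) + d + c
      shuffle = solve-∀

  Gap : List ℕ → ℕ → Set
  Gap ν q = ∀ i → i < N → β ν i ≢ q

  gap? : ∀ ν q → (Σ[ i ∈ ℕ ] i < N × β ν i ≡ q) ⊎ Gap ν q
  gap? ν q with anyUpTo? (λ i → β ν i ≟ q) N
  ... | yes bead = inj₁ bead
  ... | no  none = inj₂ λ i i<N eq → none (i , i<N , eq)

  at : ℕ → ℕ → ℕ
  at q y = 𝟙 (y ≟ q)

  arm≥ : ℕ → ℕ → ℕ
  arm≥ c y = 𝟙 ((N ≤? y) ×-dec (c ≤? y))

  window : ℕ → ℕ → ℕ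
  window q y = 𝟙 ((q ≤? y) ×-dec (y <? N))

  -- The beads at positions ≥ N are the rows with ν_i > i.
  durfee : List ℕ → ℕ
  durfee = ∑β (arm≥ 0)

  gap⇒∑β-at≡0 : ∀ ν {q} → Gap ν q → ∑β (at q) ν ≡ 0
  gap⇒∑β-at≡0 ν {q} gap = sumFrom-zeros 0 N (λ i (_ , i<N) → 𝟙-no (β ν i ≟ q) (gap i i<N))

  ∑β-at≡0⇒gap : ∀ ν {q} → ∑β (at q) ν ≡ 0 → Gap ν q
  ∑β-at≡0⇒gap ν {q} none i i<N = 𝟙≡0⇒¬ (β ν i ≟ q) (sumFrom≡0⇒zeros 0 N none i (z≤n , i<N))

  module LowestGap {ν} (P : IsPartition ν) (ν≤N : length ν ≤ N) where

    private
      L = length ν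

    h : ℕ
    h = N ∸ L

    h<β : ∀ {i} → i < L → h < β ν i
    h<β {i} i<L = begin-strict
      N ∸ L                    <⟨ ∸-monoʳ-< i<L ν≤N ⟩
      N ∸ i                    ≡⟨ suc[m∸1+n]≡m∸n (<-≤-trans i<L ν≤N) ⟨
      1 + (N ∸ suc i)          ≤⟨ +-monoˡ-≤ (N ∸ suc i) (row-positive (proj₂ P) i<L) ⟩
      row ν i + (N ∸ suc i)    ∎
      where open ≤-Reasoning

    β<h : ∀ {i} → L ≤ i → i < N → β ν i < h
    β<h {i} L≤i i<N =
      subst (_< h) (cong (_+ (N ∸ suc i)) (sym (row-beyondLength ν L≤i))) (∸-monoʳ-< (s≤s L≤i) i<N)

    bead-below-h : ∀ {p} → p < h → Σ[ i ∈ ℕ ] i < N × β ν i ≡ p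
    bead-below-h {p} p<h = N ∸ suc p , ∸-monoʳ-< {o = 0} z<s p<N , (begin
      row ν (N ∸ suc p) + (N ∸ suc (N ∸ suc p))  ≡⟨ cong (_+ _) (row-beyondLength ν L≤i) ⟩
      N ∸ suc (N ∸ suc p)                         ≡⟨ cong (N ∸_) (suc[m∸1+n]≡m∸n p<N) ⟩
      N ∸ (N ∸ p)                                 ≡⟨ m∸[m∸n]≡n (<⇒≤ p<N) ⟩
      p                                           ∎)
      where
      open ≡-Reasoning
      p<N : p < N
      p<N = <-≤-trans p<h (m∸n≤m N L)
      L≤i : L ≤ N ∸ suc p
      L≤i = ≤-trans (≤-reflexive (sym (m∸[m∸n]≡n ν≤N))) (∸-monoʳ-≤ N p<h)

    gap-h : Gap ν h
    gap-h i i<N eq with i <? L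
    ... | yes i<L = <⇒≢ (h<β i<L) (sym eq)
    ... | no  i≮L = <⇒≢ (β<h (≮⇒≥ i≮L) i<N) eq

    gap⇒h≤ : ∀ {q} → Gap ν q → h ≤ q
    gap⇒h≤ {q} gap with q <? h
    ... | no  q≮h = ≮⇒≥ q≮h
    ... | yes q<h with bead-below-h q<h
    ...   | i , i<N , eq = contradiction eq (gap i i<N)

    -- Each bead lies at a position ≥ N, in the window [h , N), or among the h beads below h.
    beadCount : durfee ν + ∑β (window h) ν + h ≡ N
    beadCount = begin
      durfee ν + ∑β (window h) ν + h  ≡⟨ cong (_+ h) (sumFrom-+ _ _ 0 N) ⟨
      sumFrom armOrWindow 0 N + h     ≡⟨ cong (_+ h) (sumFrom-cong 0 N oneBead) ⟩
      sumFrom (𝟙 ∘ (_<? L)) 0 N + h   ≡⟨ cong (_+ h) (sumFrom-zerosBeyond ν≤N λ i L≤i _ → 𝟙-no (i <? L) (≤⇒≯ L≤i)) ⟩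
      sumFrom (𝟙 ∘ (_<? L)) 0 L + h   ≡⟨ cong (_+ h) (sumFrom-ones 0 L λ i (_ , i<L) → 𝟙-yes (i <? L) i<L) ⟩
      L + h                           ≡⟨ m+[n∸m]≡n ν≤N ⟩
      N                               ∎
      where
      open ≡-Reasoning
      armOrWindow = λ i → arm≥ 0 (β ν i) + window h (β ν i)
      oneBead : ∀ i → InRange 0 N i → armOrWindow i ≡ 𝟙 (i <? L)
      oneBead i (_ , i<N) with i <? L
      ... | yes i<L with N ≤? β ν i
      ...   | yes N≤β = cong suc (𝟙-no ((h ≤? β ν i) ×-dec (β ν i <? N)) (λ (_ , β<N) → <⇒≱ β<N N≤β))
      ...   | no  N≰β = 𝟙-yes ((h ≤? β ν i) ×-dec (β ν i <? N)) (<⇒≤ (h<β i<L) , ≰⇒> N≰β)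
      oneBead i (_ , i<N) | no i≮L = cong₂ _+_
        (𝟙-no ((N ≤? β ν i) ×-dec (0 ≤? β ν i)) λ (N≤β , _) → <⇒≱ (<-≤-trans β<h′ (m∸n≤m N L)) N≤β)
        (𝟙-no ((h ≤? β ν i) ×-dec (β ν i <? N)) λ (h≤β , _) → <⇒≱ β<h′ h≤β)
        where β<h′ = β<h (≮⇒≥ i≮L) i<N

  ∑β-arm≥-antitone : ∀ μ {c c′} → c ≤ c′ → ∑β (arm≥ c′) μ ≤ ∑β (arm≥ c) μ
  ∑β-arm≥-antitone μ {c} {c′} c≤c′ = sumFrom-mono 0 N λ i _ →
    𝟙-mono ((N ≤? β μ i) ×-dec (c′ ≤? β μ i)) ((N ≤? β μ i) ×-dec (c ≤? β μ i))
      λ (N≤β , c′≤β) → N≤β , ≤-trans c≤c′ c′≤β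

  ∑β-arm≥-[] : ∀ c → ∑β (arm≥ c) [] ≡ 0
  ∑β-arm≥-[] c = sumFrom-zeros 0 N λ i (_ , i<N) →
    𝟙-no ((N ≤? β [] i) ×-dec (c ≤? β [] i)) λ (N≤β , _) → <⇒≱ (∸-monoʳ-< {o = 0} z<s i<N) N≤β

  ∑β-window-N : ∀ μ → ∑β (window N) μ ≡ 0
  ∑β-window-N μ = sumFrom-zeros 0 N λ i _ →
    𝟙-no ((N ≤? β μ i) ×-dec (β μ i <? N)) λ (N≤β , β<N) → <⇒≱ β<N N≤β

  ∑β-arm≥-suc : ∀ μ {c} → (∀ i → i < N → β μ i ≡ c → c < N) →
                ∑β (arm≥ (suc c)) μ ≡ ∑β (arm≥ c) μ
  ∑β-arm≥-suc μ {c} noArmBead = sumFrom-cong 0 N λ i (_ , i<N) →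
    𝟙-cong ((N ≤? β μ i) ×-dec (suc c ≤? β μ i)) ((N ≤? β μ i) ×-dec (c ≤? β μ i))
      (λ (N≤β , c<β) → N≤β , <⇒≤ c<β)
      (λ (N≤β , c≤β) → N≤β , ≤∧≢⇒< c≤β λ c≡β →
        <⇒≱ (noArmBead i i<N (sym c≡β)) (subst (N ≤_) (sym c≡β) N≤β))

  ∑β-window-suc : ∀ μ {c} → Gap μ c → ∑β (window (suc c)) μ ≡ ∑β (window c) μ
  ∑β-window-suc μ {c} gap = sumFrom-cong 0 N λ i (_ , i<N) →
    𝟙-cong ((suc c ≤? β μ i) ×-dec (β μ i <? N)) ((c ≤? β μ i) ×-dec (β μ i <? N))
      (λ (c<β , β<N) → <⇒≤ c<β , β<N)
      (λ (c≤β , β<N) → ≤∧≢⇒< c≤β (λ c≡β → gap i i<N (sym c≡β)) , β<N)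

  module HookStep {ν} (P : IsPartition ν) (ν≤N : length ν ≤ N) {r} (r<ν : r < length ν) where

    open LowestGap P ν≤N public using (h)

    ρ : List ℕ
    ρ = removeHook ν r

    x : ℕ
    x = β ν r

    x≡h+hook : x ≡ h + hookLength ν r
    x≡h+hook = begin
      row ν r + (N ∸ suc r)                  ≡⟨ cong (λ n → row ν r + (n ∸ suc r)) (m∸n+n≡m ν≤N) ⟨
      row ν r + (h + length ν ∸ suc r)       ≡⟨ cong (row ν r +_) (+-∸-assoc h r<ν) ⟩
      row ν r + (h + (length ν ∸ suc r))     ≡⟨ shuffle (row ν r) h _ ⟩
      h + (row ν r + (length ν ∸ suc r))     ∎
      where
      open ≡-Reasoning
      shuffle : ∀ a b c → a + (b + c) ≡ b + (a + c)
      shuffle = solve-∀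

    h<N : h < N
    h<N = ∸-monoʳ-< (≤-<-trans z≤n r<ν) ν≤N

    r<N : r < N
    r<N = <-≤-trans r<ν ν≤N

    ρ-isPartition : IsPartition ρ
    ρ-isPartition = removeHook-isPartition P r

    ρ≤N : length ρ ≤ N
    ρ≤N = ≤-trans (<⇒≤ (length-removeHook ν r<ν)) ν≤N

    h≤hρ : h ≤ N ∸ length ρ
    h≤hρ = ∸-monoʳ-≤ N (<⇒≤ (length-removeHook ν r<ν))

    arm≥-h : ∀ c → arm≥ c h ≡ 0
    arm≥-h c = 𝟙-no ((N ≤? h) ×-dec (c ≤? h)) λ (N≤h , _) → <⇒≱ h<N N≤h

    ∑β-unchanged : ∀ g → g x ≡ 0 → g h ≡ 0 → ∑β g ρ ≡ ∑β g ν
    ∑β-unchanged g gx≡0 gh≡0 = begin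
      ∑β g ρ          ≡⟨ +-identityʳ _ ⟨
      ∑β g ρ + 0      ≡⟨ cong (∑β g ρ +_) gx≡0 ⟨
      ∑β g ρ + g x    ≡⟨ ∑β-removeHook P ν≤N r<ν g ⟩
      ∑β g ν + g h    ≡⟨ cong (∑β g ν +_) gh≡0 ⟩
      ∑β g ν + 0      ≡⟨ +-identityʳ _ ⟩
      ∑β g ν          ∎
      where open ≡-Reasoning

    durfee-removeHook : durfee ρ + arm≥ 0 x ≡ durfee ν
    durfee-removeHook =
      trans (∑β-removeHook P ν≤N r<ν (arm≥ 0)) (trans (cong (durfee ν +_) (arm≥-h 0)) (+-identityʳ _))

    gap-removeHook : ∀ {q} → Gap ν q → q ≢ h → Gap ρ q
    gap-removeHook {q} gap q≢h = ∑β-at≡0⇒gap ρ (m+n≡0⇒m≡0 _ (begin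
      ∑β (at q) ρ + at q x   ≡⟨ ∑β-removeHook P ν≤N r<ν (at q) ⟩
      ∑β (at q) ν + at q h   ≡⟨ cong₂ _+_ (gap⇒∑β-at≡0 ν gap) (𝟙-no (h ≟ q) (q≢h ∘ sym)) ⟩
      0                      ∎))
      where open ≡-Reasoning

    gap-removeHook⁻ : ∀ {q} → Gap ρ q → x ≢ q → Gap ν q × h < q
    gap-removeHook⁻ {q} gap x≢q = gapν , ≤∧≢⇒< (LowestGap.gap⇒h≤ P ν≤N gapν) (𝟙≡0⇒¬ (h ≟ q) at-h≡0)
      where
      open ≡-Reasoning
      sum≡0 : ∑β (at q) ν + at q h ≡ 0
      sum≡0 = begin
        ∑β (at q) ν + at q h   ≡⟨ ∑β-removeHook P ν≤N r<ν (at q) ⟨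
        ∑β (at q) ρ + at q x   ≡⟨ cong₂ _+_ (gap⇒∑β-at≡0 ρ gap) (𝟙-no (x ≟ q) x≢q) ⟩
        0                      ∎
      gapν = ∑β-at≡0⇒gap ν (m+n≡0⇒m≡0 _ sum≡0)
      at-h≡0 = m+n≡0⇒n≡0 (∑β (at q) ν) sum≡0

    gapN-removeHook : Gap ν N → Gap ρ N
    gapN-removeHook gapN = gap-removeHook gapN (<⇒≢ h<N ∘ sym)

-- Tight partitions

IsK∨1 : ℕ → ℕ → Set
IsK∨1 k m = m ≡ k ⊎ m ≡ 1

module Tightness (N k : ℕ) where

  open Abacus N

  TightAt : List ℕ → ℕ → Set
  TightAt ν q = ∑β (arm≥ (q + k)) ν + ∑β (window q) ν + q ≡ N

  Tight : List ℕ → Set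
  Tight ν = ∀ q → q ≤ N → Gap ν q → TightAt ν q

  tight-[] : Tight []
  tight-[] q q≤N gap with ≤-antisym q≤N (LowestGap.gap⇒h≤ ([] , []) z≤n gap)
  ... | refl = cong (_+ N) (cong₂ _+_ (∑β-arm≥-[] (N + k)) (∑β-window-N []))

  tight⇒arm≥≡durfee : ∀ {μ} → IsPartition μ → (μ≤N : length μ ≤ N) → Tight μ →
                      ∑β (arm≥ (N ∸ length μ + k)) μ ≡ durfee μ
  tight⇒arm≥≡durfee {μ} P μ≤N tight = +-cancelʳ-≡ (∑β (window h) μ + h) _ _ (begin
    ∑β (arm≥ (h + k)) μ + (∑β (window h) μ + h)  ≡⟨ +-assoc (∑β (arm≥ (h + k)) μ) _ h ⟨
    ∑β (arm≥ (h + k)) μ + ∑β (window h) μ + h    ≡⟨ tight h (m∸n≤m N (length μ)) gap-h ⟩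
    N                                            ≡⟨ beadCount ⟨
    durfee μ + ∑β (window h) μ + h               ≡⟨ +-assoc (durfee μ) _ h ⟩
    durfee μ + (∑β (window h) μ + h)             ∎)
    where
    open ≡-Reasoning
    open LowestGap P μ≤N

  module _ {ν} (P : IsPartition ν) (ν≤N : length ν ≤ N) {r} (r<ν : r < length ν) where

    open HookStep P ν≤N r<ν
    open LowestGap P ν≤N using (gap-h; gap⇒h≤; beadCount)

    private
      m = hookLength ν r

      bead-x : Gap ν x → ⊥
      bead-x gap = gap r r<N refl

      1-hook⇒x≡1+h : m ≡ 1 → x ≡ suc h
      1-hook⇒x≡1+h m≡1 = trans x≡h+hook (trans (cong (h +_) m≡1) (+-comm h 1))

      k-hook⇒x≡h+k : m ≡ k → x ≡ h + k
      k-hook⇒x≡h+k m≡k = trans x≡h+hook (cong (h +_) m≡k)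

      counts-unchanged : ∀ {q} → h < q → arm≥ (q + k) x ≡ 0 → window q x ≡ 0 →
                         ∑β (arm≥ (q + k)) ρ + ∑β (window q) ρ ≡ ∑β (arm≥ (q + k)) ν + ∑β (window q) ν
      counts-unchanged {q} h<q arm≡0 window≡0 = cong₂ _+_
        (∑β-unchanged (arm≥ (q + k)) arm≡0 (arm≥-h (q + k)))
        (∑β-unchanged (window q) window≡0 (𝟙-no ((q ≤? h) ×-dec (h <? N)) λ (q≤h , _) → <⇒≱ h<q q≤h))

    1-hook⇒x<N : Gap ν N → m ≡ 1 → x < N
    1-hook⇒x<N gapN m≡1 =
      ≤∧≢⇒< (subst (_≤ N) (sym (1-hook⇒x≡1+h m≡1)) h<N) λ x≡N → bead-x (subst (Gap ν) (sym x≡N) gapN)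

    arm-hook⇒k-hook : Gap ν N → IsK∨1 k m → N ≤ x → m ≡ k
    arm-hook⇒k-hook gapN (inj₁ m≡k) N≤x = m≡k
    arm-hook⇒k-hook gapN (inj₂ m≡1) N≤x = contradiction N≤x (<⇒≱ (1-hook⇒x<N gapN m≡1))

    arm≥0-x≤𝟙[k-hook] : Gap ν N → IsK∨1 k m → arm≥ 0 x ≤ 𝟙 (m ≟ k)
    arm≥0-x≤𝟙[k-hook] gapN m∈ =
      𝟙-mono ((N ≤? x) ×-dec (0 ≤? x)) (m ≟ k) (arm-hook⇒k-hook gapN m∈ ∘ proj₁)

    tight-addHook : Gap ν N → IsK∨1 k m → (m ≡ k → N ≤ x) → Tight ρ → Tight ν
    tight-addHook gapN m∈ k-hook⇒arm tightρ q q≤N gap with q ≟ h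
    ... | yes refl = trans (cong (λ a → a + ∑β (window h) ν + h) arms-above-h+k) beadCount
      where
      open ≤-Reasoning
      all-arms-above = tight⇒arm≥≡durfee ρ-isPartition ρ≤N tightρ
      arm≥0-x≤ : arm≥ 0 x ≤ arm≥ (h + k) x
      arm≥0-x≤ = 𝟙-mono ((N ≤? x) ×-dec (0 ≤? x)) ((N ≤? x) ×-dec (h + k ≤? x)) λ (N≤x , _) →
        N≤x , ≤-reflexive (sym (k-hook⇒x≡h+k (arm-hook⇒k-hook gapN m∈ N≤x)))
      arms-above-h+k : ∑β (arm≥ (h + k)) ν ≡ durfee ν
      arms-above-h+k = ≤-antisym (∑β-arm≥-antitone ν z≤n) (begin
        durfee ν                                   ≡⟨ durfee-removeHook ⟨
        durfee ρ + arm≥ 0 x                        ≡⟨ cong (_+ arm≥ 0 x) all-arms-above ⟨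
        ∑β (arm≥ (N ∸ length ρ + k)) ρ + arm≥ 0 x  ≤⟨ +-mono-≤ (∑β-arm≥-antitone ρ (+-monoˡ-≤ k h≤hρ)) arm≥0-x≤ ⟩
        ∑β (arm≥ (h + k)) ρ + arm≥ (h + k) x       ≡⟨ ∑β-removeHook P ν≤N r<ν (arm≥ (h + k)) ⟩
        ∑β (arm≥ (h + k)) ν + arm≥ (h + k) h       ≡⟨ cong (∑β (arm≥ (h + k)) ν +_) (arm≥-h (h + k)) ⟩
        ∑β (arm≥ (h + k)) ν + 0                    ≡⟨ +-identityʳ _ ⟩
        ∑β (arm≥ (h + k)) ν                        ∎)
    ... | no q≢h = trans (cong (_+ q) (sym (counts-unchanged h<q arm≡0 window≡0)))
                         (tightρ q q≤N (gap-removeHook gap q≢h))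
      where
      h<q = ≤∧≢⇒< (gap⇒h≤ gap) (q≢h ∘ sym)
      arm≡0 = 𝟙-no ((N ≤? x) ×-dec (q + k ≤? x)) λ (N≤x , q+k≤x) →
        <⇒≱ (+-monoˡ-< k h<q) (subst (q + k ≤_) (k-hook⇒x≡h+k (arm-hook⇒k-hook gapN m∈ N≤x)) q+k≤x)
      x∉window : IsK∨1 k m → ¬ (q ≤ x × x < N)
      x∉window (inj₁ m≡k) (_ , x<N) = <⇒≱ x<N (k-hook⇒arm m≡k)
      x∉window (inj₂ m≡1) (q≤x , _) = bead-x (subst (Gap ν) (sym x≡q) gap)
        where x≡q = ≤-antisym (subst (_≤ q) (sym (1-hook⇒x≡1+h m≡1)) h<q) q≤x
      window≡0 = 𝟙-no ((q ≤? x) ×-dec (x <? N)) (x∉window m∈)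

    tight-removeArmHook : Gap ν N → Tight ν → m ≡ k → N ≤ x → Tight ρ
    tight-removeArmHook gapN tightν m≡k N≤x q q≤N gapρ =
      trans (cong (_+ q) (counts-unchanged h<q arm≡0 window≡0)) (tightν q q≤N gapν)
      where
      x≢q : x ≢ q
      x≢q x≡q = bead-x (subst (Gap ν) (sym (≤-antisym (subst (_≤ N) (sym x≡q) q≤N) N≤x)) gapN)
      gapν = proj₁ (gap-removeHook⁻ gapρ x≢q)
      h<q  = proj₂ (gap-removeHook⁻ gapρ x≢q)
      arm≡0 = 𝟙-no ((N ≤? x) ×-dec (q + k ≤? x)) λ (_ , q+k≤x) →
        <⇒≱ (+-monoˡ-< k h<q) (subst (q + k ≤_) (k-hook⇒x≡h+k m≡k) q+k≤x)
      window≡0 = 𝟙-no ((q ≤? x) ×-dec (x <? N)) λ (_ , x<N) → <⇒≱ x<N N≤x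

    tight-removeUnitHook : Gap ν N → Tight ν → m ≡ 1 → (∀ i → i < N → β ν i ≡ h + k → h + k < N) →
                           Tight ρ
    tight-removeUnitHook gapN tightν m≡1 noArmBead q q≤N gapρ with q ≟ x
    ... | yes refl = begin
      ∑β (arm≥ (x + k)) ρ + ∑β (window x) ρ + x  ≡⟨ cong₂ (λ a y → a + ∑β (window x) ρ + y) arms x≡1+h ⟩
      armsν + ∑β (window x) ρ + suc h            ≡⟨ shuffle armsν (∑β (window x) ρ) h ⟩
      armsν + (∑β (window x) ρ + 1) + h          ≡⟨ cong (λ w → armsν + w + h) windows ⟩
      armsν + ∑β (window h) ν + h                ≡⟨ tightν h (<⇒≤ h<N) gap-h ⟩
      N                                          ∎
      where
      open ≡-Reasoning
      x≡1+h = 1-hook⇒x≡1+h m≡1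
      x<N   = 1-hook⇒x<N gapN m≡1
      armsν = ∑β (arm≥ (h + k)) ν
      arms : ∑β (arm≥ (x + k)) ρ ≡ armsν
      arms = begin
        ∑β (arm≥ (x + k)) ρ      ≡⟨ ∑β-unchanged (arm≥ (x + k)) arm≡0 (arm≥-h (x + k)) ⟩
        ∑β (arm≥ (x + k)) ν      ≡⟨ cong (λ y → ∑β (arm≥ (y + k)) ν) x≡1+h ⟩
        ∑β (arm≥ (suc h + k)) ν  ≡⟨ ∑β-arm≥-suc ν noArmBead ⟩
        ∑β (arm≥ (h + k)) ν      ∎
        where arm≡0 = 𝟙-no ((N ≤? x) ×-dec (x + k ≤? x)) λ (N≤x , _) → <⇒≱ x<N N≤x
      windows : ∑β (window x) ρ + 1 ≡ ∑β (window h) ν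
      windows = begin
        ∑β (window x) ρ + 1           ≡⟨ cong (∑β (window x) ρ +_) x∈window ⟨
        ∑β (window x) ρ + window x x  ≡⟨ ∑β-removeHook P ν≤N r<ν (window x) ⟩
        ∑β (window x) ν + window x h  ≡⟨ cong (∑β (window x) ν +_) h∉window ⟩
        ∑β (window x) ν + 0           ≡⟨ +-identityʳ _ ⟩
        ∑β (window x) ν               ≡⟨ cong (λ y → ∑β (window y) ν) x≡1+h ⟩
        ∑β (window (suc h)) ν         ≡⟨ ∑β-window-suc ν gap-h ⟩
        ∑β (window h) ν               ∎
        where
        x∈window = 𝟙-yes ((x ≤? x) ×-dec (x <? N)) (≤-refl , x<N)
        h∉window = 𝟙-no ((x ≤? h) ×-dec (h <? N)) λ (x≤h , _) → <⇒≱ (≤-reflexive (sym x≡1+h)) x≤h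
      shuffle : ∀ a w h → a + w + suc h ≡ a + (w + 1) + h
      shuffle = solve-∀
    ... | no x≢q = trans (cong (_+ q) (counts-unchanged h<q arm≡0 window≡0)) (tightν q q≤N gapν)
      where
      x<N  = 1-hook⇒x<N gapN m≡1
      gapν = proj₁ (gap-removeHook⁻ gapρ (x≢q ∘ sym))
      x<q  = ≤∧≢⇒< (subst (_≤ q) (sym (1-hook⇒x≡1+h m≡1)) (proj₂ (gap-removeHook⁻ gapρ (x≢q ∘ sym))))
                   (x≢q ∘ sym)
      h<q  = <-trans (n<1+n h) (subst (_< q) (1-hook⇒x≡1+h m≡1) x<q)
      arm≡0 = 𝟙-no ((N ≤? x) ×-dec (q + k ≤? x)) λ (N≤x , _) → <⇒≱ x<N N≤x
      window≡0 = 𝟙-no ((q ≤? x) ×-dec (x <? N)) λ (q≤x , _) → <⇒≱ x<q q≤x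

    durfee-addHook : Gap ν N → IsK∨1 k m → ∀ {a} → durfee ρ ≤ a → (a ≡ durfee ρ → Tight ρ) →
                     durfee ν ≤ a + 𝟙 (m ≟ k) × (a + 𝟙 (m ≟ k) ≡ durfee ν → Tight ν)
    durfee-addHook gapN m∈ {a} durfeeρ≤a tightρ = durfeeν≤ , tightν
      where
      arm≤ = arm≥0-x≤𝟙[k-hook] gapN m∈
      durfeeν≤ : durfee ν ≤ a + 𝟙 (m ≟ k)
      durfeeν≤ = subst (_≤ a + 𝟙 (m ≟ k)) durfee-removeHook (+-mono-≤ durfeeρ≤a arm≤)
      tightν : a + 𝟙 (m ≟ k) ≡ durfee ν → Tight ν
      tightν eq = tight-addHook gapN m∈ k-hook⇒arm (tightρ (sym (proj₁ parts)))
        where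
        parts = m≤n∧o≤p∧m+o≡n+p⇒m≡n×o≡p durfeeρ≤a arm≤ (trans durfee-removeHook (sym eq))
        k-hook⇒arm : m ≡ k → N ≤ x
        k-hook⇒arm m≡k =
          proj₁ (𝟙≡1⇒ ((N ≤? x) ×-dec (0 ≤? x)) (trans (proj₂ parts) (𝟙-yes (m ≟ k) m≡k)))

-- Decompositions into first-column hooks of sizes k and 1

multiplicity : ℕ → List ℕ → ℕ
multiplicity k α = length (filter (_≟ k) α)

multiplicity-++ : ∀ k α β → multiplicity k (α ++ β) ≡ multiplicity k α + multiplicity k β
multiplicity-++ k α β = trans (cong length (filter-++ (_≟ k) α β)) (length-++ (filter (_≟ k) α))

multiplicity-accept : ∀ {k x} α → x ≡ k → multiplicity k (x ∷ α) ≡ suc (multiplicity k α)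
multiplicity-accept {k} α x≡k = cong length (filter-accept (_≟ k) x≡k)

multiplicity-reject : ∀ {k x} α → x ≢ k → multiplicity k (x ∷ α) ≡ multiplicity k α
multiplicity-reject {k} α x≢k = cong length (filter-reject (_≟ k) x≢k)

multiplicity-↭ : ∀ k {α β} → α ↭ β → multiplicity k α ≡ multiplicity k β
multiplicity-↭ k α↭β = ↭-length (filter-↭ (_≟ k) α↭β)

multiplicity-replicate : ∀ k n → multiplicity k (replicate n k) ≡ n
multiplicity-replicate k zero    = refl
multiplicity-replicate k (suc n) =
  trans (multiplicity-accept (replicate n k) refl) (cong suc (multiplicity-replicate k n))

multiplicity-replicate-≢ : ∀ {k x} n → x ≢ k → multiplicity k (replicate n x) ≡ 0
multiplicity-replicate-≢ zero    x≢k = refl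
multiplicity-replicate-≢ (suc n) x≢k =
  trans (multiplicity-reject (replicate n _) x≢k) (multiplicity-replicate-≢ n x≢k)

multiplicity-single : ∀ {k} m → multiplicity k [ m ] ≡ 𝟙 (m ≟ k)
multiplicity-single {k} m with m ≟ k
... | yes m≡k = multiplicity-accept [] m≡k
... | no  m≢k = multiplicity-reject [] m≢k

rht-isPartition : ∀ {ν α} → RHT ν α → IsPartition ν
rht-isPartition empty                 = [] , []
rht-isPartition (add ν m t P R size) = P

k∨1≢0 : ∀ {k m} → 1 < k → IsK∨1 k m → m ≢ 0
k∨1≢0 1<k (inj₁ refl) refl = contradiction 1<k λ ()
k∨1≢0 1<k (inj₂ refl) ()

module FirstColumnDecompositions (N k : ℕ) (1<k : 1 < k) where

  open Abacus N
  open Tightness N k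

  durfee≤multiplicity : ∀ {ν α} (t : RHT ν α) → RibbonsMeetFirstColumn t → All (IsK∨1 k) α →
                        length ν ≤ N → Gap ν N →
                        durfee ν ≤ multiplicity k α × (multiplicity k α ≡ durfee ν → Tight ν)
  durfee≤multiplicity empty _ _ _ _ = ≤-reflexive (∑β-arm≥-[] 0) , λ _ → tight-[]
  durfee≤multiplicity (add {σ} {α} ν m t Pν R size) (m≡0∨cell , meets) sizes ν≤N gapN
    with ++⁻ʳ α sizes | m≡0∨cell
  ... | m∈ ∷ [] | inj₁ m≡0 = contradiction m≡0 (k∨1≢0 1<k m∈)
  ... | m∈ ∷ [] | inj₂ (i₀ , cell) =
    subst (λ b → durfee ν ≤ b × (b ≡ durfee ν → Tight ν)) (sym multiplicity≡) bound
    where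
    hook = firstColumnRibbon⇒removeHook Pν (rht-isPartition t) R cell
    r = proj₁ hook
    r<ν = proj₁ (proj₂ hook)
    σ≡ρ = proj₂ (proj₂ hook)
    open HookStep Pν ν≤N r<ν
    m≡hook : m ≡ hookLength ν r
    m≡hook = trans (sym size) (trans (cong (skewSize ν) σ≡ρ) (skewSize-removeHook Pν r<ν))
    a = multiplicity k α
    IH : durfee σ ≤ a × (a ≡ durfee σ → Tight σ)
    IH = durfee≤multiplicity t meets (++⁻ˡ α sizes) (subst (λ μ → length μ ≤ N) (sym σ≡ρ) ρ≤N)
                             (subst (λ μ → Gap μ N) (sym σ≡ρ) (gapN-removeHook gapN))
    IHρ : durfee ρ ≤ a × (a ≡ durfee ρ → Tight ρ)
    IHρ = subst (λ μ → durfee μ ≤ a × (a ≡ durfee μ → Tight μ)) σ≡ρ IH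
    bound = durfee-addHook Pν ν≤N r<ν gapN (subst (IsK∨1 k) m≡hook m∈) (proj₁ IHρ) (proj₂ IHρ)
    multiplicity≡ : multiplicity k (α ++ [ m ]) ≡ a + 𝟙 (hookLength ν r ≟ k)
    multiplicity≡ = trans (multiplicity-++ k α [ m ])
                          (cong (a +_) (trans (multiplicity-single m) (cong (λ n → 𝟙 (n ≟ k)) m≡hook)))

  Decomposition : List ℕ → Set
  Decomposition ν = Σ[ α ∈ List ℕ ] Σ[ t ∈ RHT ν α ]
    RibbonsMeetFirstColumn t × All (IsK∨1 k) α × multiplicity k α ≡ durfee ν × sum α ≡ sum ν

  decomposition-addHook : ∀ {x xs} (P : IsPartition (x ∷ xs)) {r} → r ≤ length xs →
                          let ν = x ∷ xs ; m = hookLength ν r in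
                          IsK∨1 k m → durfee (removeHook ν r) + 𝟙 (m ≟ k) ≡ durfee ν →
                          Decomposition (removeHook ν r) → Decomposition ν
  decomposition-addHook {x} {xs} P {r} r≤ m∈ durfee≡ (α , t , meets , sizes , multiplicity≡ , sum≡) =
    α ++ [ m ] ,
    add ν m t P isRibbon (skewSize-removeHook P (s≤s r≤)) ,
    (inj₂ (length xs , lastRowCell) , meets) ,
    ++⁺ sizes (m∈ ∷ []) ,
    trans (multiplicity-++ k α [ m ]) (trans (cong₂ _+_ multiplicity≡ (multiplicity-single m)) durfee≡) ,
    trans (sum-++ α [ m ]) (trans (cong₂ _+_ sum≡ (+-identityʳ m)) (sym (sum-removeHook P (s≤s r≤))))
    where
    ν = x ∷ xs
    m = hookLength ν r
    open HookRibbon P r≤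

  module GreedyStep {y ys} (P : IsPartition (y ∷ ys)) (ν≤N : length (y ∷ ys) ≤ N)
                    (gapN : Gap (y ∷ ys) N) (tight : Tight (y ∷ ys))
                    (decompose : ∀ {r} → r < length (y ∷ ys) → Tight (removeHook (y ∷ ys) r) →
                                 Decomposition (removeHook (y ∷ ys) r)) where

    private
      ν = y ∷ ys
    open LowestGap P ν≤N using (h; β<h; gap-h)

    removeHookAt : ∀ {i} (i<ν : i < length ν) → let m = hookLength ν i in
                   IsK∨1 k m → arm≥ 0 (β ν i) ≡ 𝟙 (m ≟ k) → Tight (removeHook ν i) → Decomposition ν
    removeHookAt i<ν m∈ arm≡ tightρ = decomposition-addHook P (≤-pred i<ν) m∈
      (trans (cong (durfee ρ +_) (sym arm≡)) durfee-removeHook) (decompose i<ν tightρ)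
      where open HookStep P ν≤N i<ν hiding (h)

    h<bead⇒<length : ∀ {i} → i < N → h < β ν i → i < length ν
    h<bead⇒<length {i} i<N h<β with i <? length ν
    ... | yes i<ν = i<ν
    ... | no  i≮ν = contradiction h<β (<⇒≯ (β<h (≮⇒≥ i≮ν) i<N))

    -- Tightness at the gaps h and h + 1 would give two different bead counts.
    bead-at-1+h : (∀ i → i < N → β ν i ≡ h + k → h + k < N) → Σ[ i ∈ ℕ ] i < N × β ν i ≡ suc h
    bead-at-1+h noArmBead with gap? ν (suc h)
    ... | inj₁ bead = bead
    ... | inj₂ gap  = contradiction (begin
      suc (∑β (arm≥ (h + k)) ν + ∑β (window h) ν + h)            ≡⟨ cong₂ (λ a w → suc (a + w + h)) arms wins ⟨
      suc (∑β (arm≥ (suc h + k)) ν + ∑β (window (suc h)) ν + h)  ≡⟨ +-suc _ h ⟨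
      ∑β (arm≥ (suc h + k)) ν + ∑β (window (suc h)) ν + suc h    ≡⟨ tight (suc h) h<N gap ⟩
      N                                                          ≡⟨ tight h (<⇒≤ h<N) gap-h ⟨
      ∑β (arm≥ (h + k)) ν + ∑β (window h) ν + h                  ∎) 1+n≢n
      where
      open ≡-Reasoning
      h<N = ∸-monoʳ-< z<s ν≤N
      arms = ∑β-arm≥-suc ν noArmBead
      wins = ∑β-window-suc ν gap-h

    removeUnitHook : (∀ i → i < N → β ν i ≡ h + k → h + k < N) → Decomposition ν
    removeUnitHook noArmBead = removeHookAt i<ν (inj₂ hook≡1) arm≡
      (tight-removeUnitHook P ν≤N i<ν gapN tight hook≡1 noArmBead)
      where
      i = proj₁ (bead-at-1+h noArmBead)
      i<N = proj₁ (proj₂ (bead-at-1+h noArmBead))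
      β≡1+h = proj₂ (proj₂ (bead-at-1+h noArmBead))
      i<ν = h<bead⇒<length i<N (≤-reflexive (sym β≡1+h))
      open HookStep P ν≤N i<ν hiding (h)
      hook≡1 = +-cancelˡ-≡ h _ _ (trans (sym x≡h+hook) (trans β≡1+h (+-comm 1 h)))
      arm≡ : arm≥ 0 x ≡ 𝟙 (hookLength ν i ≟ k)
      arm≡ = trans (𝟙-no ((N ≤? x) ×-dec (0 ≤? x)) λ (N≤x , _) → <⇒≱ x<N N≤x)
                   (sym (𝟙-no (_ ≟ k) λ hook≡k → <⇒≢ 1<k (trans (sym hook≡1) hook≡k)))
        where x<N = 1-hook⇒x<N P ν≤N i<ν gapN hook≡1

    decomposition : Decomposition ν
    decomposition with gap? ν (h + k)
    ... | inj₂ gap = removeUnitHook λ i i<N β≡h+k → contradiction β≡h+k (gap i i<N)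
    ... | inj₁ (i , i<N , β≡h+k) with N ≤? h + k
    ...   | no  N≰h+k = removeUnitHook λ _ _ _ → ≰⇒> N≰h+k
    ...   | yes N≤h+k =
      removeHookAt i<ν (inj₁ hook≡k) arm≡ (tight-removeArmHook P ν≤N i<ν gapN tight hook≡k N≤x)
      where
      i<ν = h<bead⇒<length i<N (subst (h <_) (sym β≡h+k) (m<m+n h (<-trans z<s 1<k)))
      open HookStep P ν≤N i<ν hiding (h)
      hook≡k = +-cancelˡ-≡ h _ _ (trans (sym x≡h+hook) β≡h+k)
      N≤x = subst (N ≤_) (sym β≡h+k) N≤h+k
      arm≡ : arm≥ 0 x ≡ 𝟙 (hookLength ν i ≟ k)
      arm≡ = trans (𝟙-yes ((N ≤? x) ×-dec (0 ≤? x)) (N≤x , z≤n)) (sym (𝟙-yes (_ ≟ k) hook≡k))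

  greedyDecomposition : ∀ n {ν} → length ν ≤ n → IsPartition ν → length ν ≤ N → Gap ν N → Tight ν →
                        Decomposition ν
  greedyDecomposition n {[]} _ _ _ _ _ = [] , empty , _ , [] , sym (∑β-arm≥-[] 0) , refl
  greedyDecomposition (suc n) {x ∷ xs} (s≤s L≤n) P ν≤N gapN tight =
    GreedyStep.decomposition P ν≤N gapN tight λ {r} r<ν tightρ →
      greedyDecomposition n (≤-trans (≤-pred (length-removeHook (x ∷ xs) r<ν)) L≤n)
        (removeHook-isPartition P r) (HookStep.ρ≤N P ν≤N r<ν) (HookStep.gapN-removeHook P ν≤N r<ν gapN) tightρ

-- Almost self-conjugate partitions

FrobeniusConditions : ℕ → List ℕ → ℕ → Set
FrobeniusConditions k lam d =
  (∀ j → 1 ≤ j → j ≤ d → frob lam d j + frob lam d ((d + 1) ∸ j) ≥ k) ×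
  (∀ j → 1 ≤ j → j ≤ d → frob lam d (j + 1) + frob lam d ((d + 1) ∸ j) < k)

frob-< : ∀ lam {d j} → j < d → frob lam d (suc j) ≡ row lam j ∸ suc j
frob-< lam {d} {j} j<d with suc j ≤ᵇ d | ≤⇒≤ᵇ j<d
... | true | _ = cong (_∸ suc j) (part-suc lam j)

frob-> : ∀ lam {d j} → d < j → frob lam d j ≡ 0
frob-> lam {d} {j} d<j with j ≤ᵇ d in eq
... | true  = contradiction (≤ᵇ⇒≤ j d (subst T (sym eq) _)) (<⇒≱ d<j)
... | false = refl

rank⇒<row : ∀ {lam d} → Linked _≥_ lam → d ≡ 0 ⊎ part lam d ≥ d → ∀ {i} → i < d → i < row lam i
rank⇒<row {lam} {suc d} l (inj₂ 1+d≤λ) {i} (s≤s i≤d) = begin-strict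
  i                    ≤⟨ i≤d ⟩
  d                    <⟨ 1+d≤λ ⟩
  part lam (suc d)     ≡⟨ part-suc lam d ⟩
  row lam d            ≤⟨ row-antitone l i≤d ⟩
  row lam i            ∎
  where open ≤-Reasoning

rank⇒≤length : ∀ {lam d} → Linked _≥_ lam → d ≡ 0 ⊎ part lam d ≥ d → d ≤ length lam
rank⇒≤length {lam} {zero}  l _    = z≤n
rank⇒≤length {lam} {suc d} l rank = row-positive⇒<length lam (≤-<-trans z≤n (rank⇒<row l rank ≤-refl))

module AlmostSelfConjugate (k : ℕ) {lam : List ℕ} (P : IsPartition lam) {d : ℕ}
                           (rank : HasRank lam d) (asc : IsASC lam d) where

  N : ℕ
  N = length lam

  open Abacus N
  open Tightness N k

  private
    R = row lam
    l = proj₁ P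

  -- The arm Frobenius coordinate f_(i+1), indexed from 0.
  F : ℕ → ℕ
  F i = R i ∸ suc i

  F-antitone : ∀ {i j} → i ≤ j → F j ≤ F i
  F-antitone i≤j = ∸-mono (row-antitone l i≤j) (s≤s i≤j)

  rank≤⇒row≤ : ∀ {i} → d ≤ i → R i ≤ i
  rank≤⇒row≤ {i} d≤i = ≤-pred (subst (_< suc i) (part-suc lam i) (proj₂ rank (suc i) (s≤s d≤i)))

  d≤N : d ≤ N
  d≤N = rank⇒≤length l (proj₁ rank)

  <d⇒<row : ∀ {i} → i < d → i < R i
  <d⇒<row = rank⇒<row l (proj₁ rank)

  row≡1+column : ∀ {i} → i < d → R i ≡ suc (conjPart lam (suc i))
  row≡1+column {i} i<d = trans (sym (part-suc lam i)) (trans (asc (suc i) (s≤s z≤n) i<d) (+-comm _ 1))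

  F≡column∸ : ∀ {i} → i < d → F i ≡ conjPart lam (suc i) ∸ i
  F≡column∸ i<d = cong (_∸ suc _) (row≡1+column i<d)

  i<column : ∀ {i} → i < d → i < conjPart lam (suc i)
  i<column i<d = <row⇒<conjPart l (<d⇒<row i<d)

  F+i≡column : ∀ {i} → i < d → F i + i ≡ conjPart lam (suc i)
  F+i≡column {i} i<d = trans (cong (_+ i) (F≡column∸ i<d)) (m∸n+n≡m (<⇒≤ (i<column i<d)))

  F-positive : ∀ {i} → i < d → 1 ≤ F i
  F-positive i<d = subst (1 ≤_) (sym (F≡column∸ i<d)) (m<n⇒0<n∸m (i<column i<d))

  β-arm : ∀ {i} → i < d → β lam i ≡ F i + N
  β-arm {i} i<d = begin
    R i + (N ∸ suc i)              ≡⟨ cong (_+ (N ∸ suc i)) (m∸n+n≡m (<d⇒<row i<d)) ⟨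
    F i + suc i + (N ∸ suc i)      ≡⟨ +-assoc (F i) (suc i) _ ⟩
    F i + (suc i + (N ∸ suc i))    ≡⟨ cong (F i +_) (m+[n∸m]≡n (<-≤-trans i<d d≤N)) ⟩
    F i + N                        ∎
    where open ≡-Reasoning

  N<β-arm : ∀ {i} → i < d → N < β lam i
  N<β-arm {i} i<d = subst (N <_) (sym (β-arm i<d)) (+-monoˡ-≤ N (F-positive i<d))

  β<N : ∀ {i} → d ≤ i → i < N → β lam i < N
  β<N {i} d≤i i<N =
    subst (R i + (N ∸ suc i) <_) (m+[n∸m]≡n i<N) (+-monoˡ-< (N ∸ suc i) (s≤s (rank≤⇒row≤ d≤i)))

  gapN : Gap lam N
  gapN i i<N β≡N with i <? d
  ... | yes i<d = <⇒≢ (N<β-arm i<d) (sym β≡N)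
  ... | no  i≮d = <⇒≢ (β<N (≮⇒≥ i≮d) i<N) β≡N

  durfee≡d : durfee lam ≡ d
  durfee≡d = trans (sumFrom-zerosBeyond d≤N noArm) (sumFrom-ones 0 d arm)
    where
    noArm : ∀ i → d ≤ i → i < N → arm≥ 0 (β lam i) ≡ 0
    noArm i d≤i i<N = 𝟙-no ((N ≤? β lam i) ×-dec (0 ≤? β lam i)) λ (N≤β , _) → <⇒≱ (β<N d≤i i<N) N≤β
    arm : ∀ i → InRange 0 d i → arm≥ 0 (β lam i) ≡ 1
    arm i (_ , i<d) = 𝟙-yes ((N ≤? β lam i) ×-dec (0 ≤? β lam i)) (<⇒≤ (N<β-arm i<d) , z≤n)

  pairCount : ℕ → ℕ
  pairCount j = count (λ i → k ≤? F i + F j) d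

  module ArmGap {j} (j<d : j < d) where

    c : ℕ
    c = conjPart lam (suc j)

    q : ℕ
    q = N ∸ F j

    F≤N : F j ≤ N
    F≤N = ≤-trans (m≤m+n (F j) j) (≤-trans (≤-reflexive (F+i≡column j<d)) (conjPart≤length lam (suc j)))

    q+F≡N : q + F j ≡ N
    q+F≡N = m∸n+n≡m F≤N

    q<N : q < N
    q<N = ∸-monoʳ-< (F-positive j<d) F≤N

    d≤c : d ≤ c
    d≤c = ≮⇒≥ λ c<d → n≮n c (<row⇒<conjPart l (<-trans (i<column j<d) (<d⇒<row c<d)))

    -- Comparing β lam i with q amounts to comparing R i + F j with i + 1.
    β-vs-q : ∀ {i} → i < N → suc i + β lam i ≡ (R i + F j) + q
    β-vs-q {i} i<N = begin
      suc i + (R i + (N ∸ suc i))    ≡⟨ shuffle (suc i) (R i) (N ∸ suc i) ⟩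
      R i + (suc i + (N ∸ suc i))    ≡⟨ cong (R i +_) (m+[n∸m]≡n i<N) ⟩
      R i + N                        ≡⟨ cong (R i +_) (trans (sym q+F≡N) (+-comm q (F j))) ⟩
      R i + (F j + q)                ≡⟨ +-assoc (R i) (F j) q ⟨
      R i + F j + q                  ∎
      where
      open ≡-Reasoning
      shuffle : ∀ a b e → a + (b + e) ≡ b + (a + e)
      shuffle = solve-∀

    row-above : ∀ {i} → i < c → suc i < R i + F j
    row-above {i} i<c = begin-strict
      suc i          <⟨ s≤s (subst (i <_) (sym (F+i≡column j<d)) i<c) ⟩
      suc (F j + j)  ≡⟨ +-suc (F j) j ⟨
      F j + suc j    ≤⟨ +-monoʳ-≤ (F j) (<conjPart⇒<row l i<c) ⟩
      F j + R i      ≡⟨ +-comm (F j) (R i) ⟩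
      R i + F j      ∎
      where open ≤-Reasoning

    row-below : ∀ {i} → c ≤ i → R i + F j ≤ i
    row-below {i} c≤i = begin
      R i + F j      ≤⟨ +-monoˡ-≤ (F j) (≮⇒≥ λ j<R → <⇒≱ (<row⇒<conjPart l j<R) c≤i) ⟩
      j + F j        ≡⟨ trans (+-comm j (F j)) (F+i≡column j<d) ⟩
      c              ≤⟨ c≤i ⟩
      i              ∎
      where open ≤-Reasoning

    gap-q : Gap lam q
    gap-q i i<N β≡q with i <? d | i <? c
    ... | yes i<d | _       = <⇒≢ (<-trans q<N (N<β-arm i<d)) (sym β≡q)
    ... | no  _   | yes i<c = <⇒≢ (+-≡⇒<-swap (β-vs-q i<N) (row-above i<c)) (sym β≡q)
    ... | no  _   | no  i≮c = <⇒≢ (+-≡⇒<-swap (sym (β-vs-q i<N)) (s≤s (row-below (≮⇒≥ i≮c)))) β≡q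

    window-q : ∑β (window q) lam ≡ c ∸ d
    window-q = trans
      (sumFrom-cong 0 N λ i (_ , i<N) → 𝟙-cong (inWindow? i) ((d ≤? i) ×-dec (i <? c)) (⇒ i<N) (⇐ i<N))
      (count-interval d≤c (conjPart≤length lam (suc j)))
      where
      inWindow? = λ i → (q ≤? β lam i) ×-dec (β lam i <? N)
      ⇒ : ∀ {i} → i < N → q ≤ β lam i × β lam i < N → d ≤ i × i < c
      ⇒ {i} i<N (q≤β , β<N′) =
        ≮⇒≥ (λ i<d → <⇒≱ β<N′ (<⇒≤ (N<β-arm i<d))) ,
        ≰⇒> (λ c≤i → <⇒≱ (+-≡⇒<-swap (sym (β-vs-q i<N)) (s≤s (row-below c≤i))) q≤β)
      ⇐ : ∀ {i} → i < N → d ≤ i × i < c → q ≤ β lam i × β lam i < N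
      ⇐ {i} i<N (d≤i , i<c) = <⇒≤ (+-≡⇒<-swap (β-vs-q i<N) (row-above i<c)) , β<N d≤i i<N

    arms-q : ∑β (arm≥ (q + k)) lam ≡ pairCount j
    arms-q = trans
      (sumFrom-zerosBeyond d≤N λ i d≤i i<N → 𝟙-no (arm? i) λ (N≤β , _) → <⇒≱ (β<N d≤i i<N) N≤β)
      (sumFrom-cong 0 d λ i (_ , i<d) → 𝟙-cong (arm? i) (k ≤? F i + F j)
        (λ (_ , q+k≤β) → +-cancelˡ-≤ q k _ (subst (q + k ≤_) (β≡q+[F+F] i<d) q+k≤β))
        (λ k≤F+F → <⇒≤ (N<β-arm i<d) , subst (q + k ≤_) (sym (β≡q+[F+F] i<d)) (+-monoʳ-≤ q k≤F+F)))
      where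
      arm? = λ i → (N ≤? β lam i) ×-dec (q + k ≤? β lam i)
      β≡q+[F+F] : ∀ {i} → i < d → β lam i ≡ q + (F i + F j)
      β≡q+[F+F] {i} i<d = trans (β-arm i<d) (trans (cong (F i +_) (sym q+F≡N)) (shuffle (F i) q (F j)))
        where
        shuffle : ∀ a b e → a + (b + e) ≡ b + (a + e)
        shuffle = solve-∀

    beadIdentity : ∑β (arm≥ (q + k)) lam + ∑β (window q) lam + q + d ≡ pairCount j + j + N
    beadIdentity = begin
      ∑β (arm≥ (q + k)) lam + ∑β (window q) lam + q + d   ≡⟨ cong₂ (λ a w → a + w + q + d) arms-q window-q ⟩
      pairCount j + (c ∸ d) + q + d                       ≡⟨ shuffle (pairCount j) (c ∸ d) q d ⟩
      pairCount j + q + (c ∸ d + d)                       ≡⟨ cong (pairCount j + q +_) (m∸n+n≡m d≤c) ⟩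
      pairCount j + q + c                                 ≡⟨ cong (pairCount j + q +_) (F+i≡column j<d) ⟨
      pairCount j + q + (F j + j)                         ≡⟨ shuffle′ (pairCount j) q (F j) j ⟩
      pairCount j + j + (q + F j)                         ≡⟨ cong (pairCount j + j +_) q+F≡N ⟩
      pairCount j + j + N                                 ∎
      where
      open ≡-Reasoning
      shuffle : ∀ a w b e → a + w + b + e ≡ a + b + (w + e)
      shuffle = solve-∀
      shuffle′ : ∀ a b f i → a + b + (f + i) ≡ a + i + (b + f)
      shuffle′ = solve-∀

    tight-at-q⇔ : TightAt lam q ⇔ pairCount j + j ≡ d
    tight-at-q⇔ = mk⇔
      (λ tight → +-cancelʳ-≡ N _ _ (trans (sym beadIdentity) (trans (cong (_+ d) tight) (+-comm N d))))
      (λ count≡ → +-cancelʳ-≡ d _ _ (trans beadIdentity (trans (cong (_+ N) count≡) (+-comm d N))))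

  arms-N : ∑β (arm≥ (N + k)) lam ≡ count (λ i → k ≤? F i) d
  arms-N = trans
    (sumFrom-zerosBeyond d≤N λ i d≤i i<N → 𝟙-no (arm? i) λ (N≤β , _) → <⇒≱ (β<N d≤i i<N) N≤β)
    (sumFrom-cong 0 d λ i (_ , i<d) → 𝟙-cong (arm? i) (k ≤? F i)
      (λ (_ , N+k≤β) → +-cancelˡ-≤ N k (F i) (subst (N + k ≤_) (β≡N+F i<d) N+k≤β))
      (λ k≤F → <⇒≤ (N<β-arm i<d) , subst (N + k ≤_) (sym (β≡N+F i<d)) (+-monoʳ-≤ N k≤F)))
    where
    arm? = λ i → (N ≤? β lam i) ×-dec (N + k ≤? β lam i)
    β≡N+F : ∀ {i} → i < d → β lam i ≡ N + F i
    β≡N+F i<d = trans (β-arm i<d) (+-comm _ N)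

  tight-at-N⇔ : TightAt lam N ⇔ count (λ i → k ≤? F i) d ≡ 0
  tight-at-N⇔ = mk⇔
    (λ tight → trans (sym arms-N) (m+n≡0⇒m≡0 _ (+-cancelʳ-≡ N _ 0 tight)))
    (λ count≡0 → cong (_+ N) (trans (cong₂ _+_ arms-N (∑β-window-N lam)) (trans (+-identityʳ _) count≡0)))

  -- The gaps below N are exactly the positions N ∸ f_j: walking down the rows, the first row
  -- whose bead lies below the gap q ends at the column j with f_j = N ∸ q.
  gap⇒armGap : ∀ {q} → q < N → Gap lam q → Σ[ j ∈ ℕ ] Σ[ j<d ∈ j < d ] q ≡ ArmGap.q j<d
  gap⇒armGap {q} q<N gap = j , j<d , sym (trans (cong (N ∸_) F≡c) (m∸[m∸n]≡n (<⇒≤ q<N)))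
    where
    c = N ∸ q

    vs-q : ∀ {i} → i < N → q + (R i + c) ≡ β lam i + suc i
    vs-q {i} i<N = begin
      q + (R i + c)                  ≡⟨ shuffle q (R i) c ⟩
      R i + (q + c)                  ≡⟨ cong (R i +_) (m+[n∸m]≡n (<⇒≤ q<N)) ⟩
      R i + N                        ≡⟨ cong (R i +_) (m∸n+n≡m i<N) ⟨
      R i + (N ∸ suc i + suc i)      ≡⟨ +-assoc (R i) _ (suc i) ⟨
      β lam i + suc i                ∎
      where
      open ≡-Reasoning
      shuffle : ∀ a b e → a + (b + e) ≡ b + (a + e)
      shuffle = solve-∀

    first = leastWitness (λ i → (i ≟ N) ⊎-dec (β lam i <? q)) {N} (inj₁ refl)
    m = proj₁ first
    m≤N = proj₁ (proj₂ (proj₂ first))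

    above : ∀ {i} → i < m → suc i < R i + c
    above {i} i<m = +-≡⇒<-swap (vs-q i<N)
      (≤∧≢⇒< (≮⇒≥ (proj₂ (proj₂ (proj₂ first)) i i<m ∘ inj₂)) (λ q≡β → gap i i<N (sym q≡β)))
      where i<N = <-≤-trans i<m m≤N

    at-m : m < N → R m + c ≤ m
    at-m m<N with proj₁ (proj₂ first)
    ... | inj₁ m≡N = contradiction m≡N (<⇒≢ m<N)
    ... | inj₂ β<q = ≤-pred (+-≡⇒<-swap (sym (vs-q m<N)) β<q)

    c≤m : c ≤ m
    c≤m with m <? N
    ... | yes m<N = ≤-trans (m≤n+m c (R m)) (at-m m<N)
    ... | no  m≮N = ≤-trans (m∸n≤m N q) (≮⇒≥ m≮N)

    j = m ∸ c
    1≤m = ≤-trans (m<n⇒0<n∸m q<N) c≤m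
    m′ = m ∸ 1

    j<R[m′] : j < R m′
    j<R[m′] = +-cancelʳ-≤ c (suc j) (R m′) (begin
      suc j + c         ≡⟨ cong suc (m∸n+n≡m c≤m) ⟩
      suc m             ≡⟨ cong suc (suc[n∸1]≡n 1≤m) ⟨
      suc (suc m′)      ≤⟨ above (subst (m′ <_) (suc[n∸1]≡n 1≤m) ≤-refl) ⟩
      R m′ + c          ∎)
      where open ≤-Reasoning

    column≡m : conjPart lam (suc j) ≡ m
    column≡m = ≤-antisym column≤m
      (subst (_≤ conjPart lam (suc j)) (suc[n∸1]≡n 1≤m) (<row⇒<conjPart l j<R[m′]))
      where
      column≤m : conjPart lam (suc j) ≤ m
      column≤m with m <? N
      ... | no  m≮N = ≤-trans (conjPart≤length lam (suc j)) (≮⇒≥ m≮N)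
      ... | yes m<N = ≮⇒≥ λ m<column → <⇒≱ (<conjPart⇒<row l m<column) R[m]≤j
        where
        R[m]≤j : R m ≤ j
        R[m]≤j = +-cancelʳ-≤ c (R m) j (≤-trans (at-m m<N) (≤-reflexive (sym (m∸n+n≡m c≤m))))

    j<d : j < d
    j<d with j <? d
    ... | yes j<d = j<d
    ... | no  j≮d = contradiction (≤-trans j<R[m′] (≤-trans (row-antitone l j≤m′) (rank≤⇒row≤ (≮⇒≥ j≮d))))
                                  (n≮n j)
      where
      j≤m′ : j ≤ m′
      j≤m′ = ≤-pred (subst (j <_) (sym (suc[n∸1]≡n 1≤m)) (∸-monoʳ-< {o = 0} (m<n⇒0<n∸m q<N) c≤m))

    F≡c : F j ≡ c
    F≡c = trans (F≡column∸ j<d) (trans (cong (_∸ j) column≡m) (m∸[m∸n]≡n c≤m))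

  ArmConditions : Set
  ArmConditions = (∀ j → j < d → k ≤ F j + F (d ∸ suc j))
                × (∀ j → suc j < d → F (suc j) + F (d ∸ suc j) < k)
                × (0 < d → F 0 < k)

  private
    pairCount-≥ : ∀ {a j} → a < d → k ≤ F j + F a → suc a ≤ pairCount j
    pairCount-≥ {a} {j} a<d k≤ = count-≥ (λ i → k ≤? F i + F j) a<d λ i i≤a → begin
      k          ≤⟨ k≤ ⟩
      F j + F a  ≤⟨ +-monoʳ-≤ (F j) (F-antitone (≤-pred i≤a)) ⟩
      F j + F i  ≡⟨ +-comm (F j) (F i) ⟩
      F i + F j  ∎
      where open ≤-Reasoning

    pairCount-≤ : ∀ {a j} → a ≤ d → (a < d → F j + F a < k) → pairCount j ≤ a
    pairCount-≤ {a} {j} a≤d F+F<k = count-≤ (λ i → k ≤? F i + F j) a≤d λ i a≤i i<d k≤ →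
      <⇒≱ (F+F<k (≤-<-trans a≤i i<d)) (begin
        k          ≤⟨ k≤ ⟩
        F i + F j  ≤⟨ +-monoˡ-≤ (F j) (F-antitone a≤i) ⟩
        F a + F j  ≡⟨ +-comm (F a) (F j) ⟩
        F j + F a  ∎)
      where open ≤-Reasoning

    d∸[1+j]<d : ∀ {j} → j < d → d ∸ suc j < d
    d∸[1+j]<d j<d = ∸-monoʳ-< {o = 0} z<s j<d

  tight⇒armConditions : Tight lam → ArmConditions
  tight⇒armConditions tight = c₁ , c₂ , c₃
    where
    pairCount≡ : ∀ {j} → j < d → pairCount j + j ≡ d
    pairCount≡ j<d = Equivalence.to tight-at-q⇔ (tight q (<⇒≤ q<N) gap-q)
      where open ArmGap j<d
    c₁ : ∀ j → j < d → k ≤ F j + F (d ∸ suc j)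
    c₁ j j<d with k ≤? F j + F (d ∸ suc j)
    ... | yes k≤ = k≤
    ... | no  k≰ = contradiction (pairCount≡ j<d) (<⇒≢ (begin-strict
      pairCount j + j       ≤⟨ +-monoˡ-≤ j (pairCount-≤ (m∸n≤m d (suc j)) λ _ → ≰⇒> k≰) ⟩
      d ∸ suc j + j         <⟨ +-monoʳ-< (d ∸ suc j) (n<1+n j) ⟩
      d ∸ suc j + suc j     ≡⟨ m∸n+n≡m j<d ⟩
      d                     ∎))
      where open ≤-Reasoning
    c₂ : ∀ j → suc j < d → F (suc j) + F (d ∸ suc j) < k
    c₂ j 1+j<d with F (suc j) + F (d ∸ suc j) <? k
    ... | yes F+F<k = F+F<k
    ... | no  F+F≮k = contradiction (pairCount≡ 1+j<d) (>⇒≢ (begin-strict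
      d                          ≡⟨ m∸n+n≡m j<d ⟨
      d ∸ suc j + suc j          <⟨ +-monoˡ-≤ (suc j) (pairCount-≥ (d∸[1+j]<d j<d) (≮⇒≥ F+F≮k)) ⟩
      pairCount (suc j) + suc j  ∎))
      where
      open ≤-Reasoning
      j<d = <-trans (n<1+n j) 1+j<d
    c₃ : 0 < d → F 0 < k
    c₃ 0<d with F 0 <? k
    ... | yes F<k = F<k
    ... | no  F≮k = contradiction (Equivalence.to tight-at-N⇔ (tight N ≤-refl gapN))
                      (>⇒≢ (count-≥ (λ i → k ≤? F i) 0<d λ { zero _ → ≮⇒≥ F≮k ; (suc _) (s≤s ()) }))

  armConditions⇒tight : ArmConditions → Tight lam
  armConditions⇒tight (c₁ , c₂ , c₃) q q≤N gap with q ≟ N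
  ... | yes refl = Equivalence.from tight-at-N⇔ (n≤0⇒n≡0 (count-≤ (λ i → k ≤? F i) z≤n λ i _ i<d k≤F →
                     <⇒≱ (c₃ (≤-<-trans z≤n i<d)) (≤-trans k≤F (F-antitone z≤n))))
  ... | no  q≢N with gap⇒armGap (≤∧≢⇒< q≤N q≢N) gap
  ...   | j , j<d , refl = Equivalence.from (ArmGap.tight-at-q⇔ j<d) (begin
    pairCount j + j      ≡⟨ cong (_+ j) (≤-antisym (pairCount-≤ (m∸n≤m d j) (no-pairs j j<d)) pairs≥) ⟩
    d ∸ j + j            ≡⟨ m∸n+n≡m (<⇒≤ j<d) ⟩
    d                    ∎)
    where
    open ≡-Reasoning
    pairs≥ : d ∸ j ≤ pairCount j
    pairs≥ = subst (_≤ pairCount j) (suc[m∸1+n]≡m∸n j<d) (pairCount-≥ (d∸[1+j]<d j<d) (c₁ j j<d))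
    no-pairs : ∀ j → j < d → d ∸ j < d → F j + F (d ∸ j) < k
    no-pairs zero     _      d<d = contradiction d<d (n≮n d)
    no-pairs (suc j′) 1+j′<d _   = c₂ j′ 1+j′<d

  private
    frob-mirror : ∀ {j} → j < d → frob lam d ((d + 1) ∸ suc j) ≡ F (d ∸ suc j)
    frob-mirror {j} j<d = begin
      frob lam d ((d + 1) ∸ suc j)    ≡⟨ cong (λ n → frob lam d (n ∸ suc j)) (+-comm d 1) ⟩
      frob lam d (d ∸ j)              ≡⟨ cong (frob lam d) (suc[m∸1+n]≡m∸n j<d) ⟨
      frob lam d (suc (d ∸ suc j))    ≡⟨ frob-< lam (∸-monoʳ-< {o = 0} z<s j<d) ⟩
      F (d ∸ suc j)                   ∎
      where open ≡-Reasoning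

    frob-next : ∀ {j} → suc j < d → frob lam d (suc j + 1) ≡ F (suc j)
    frob-next {j} 1+j<d = trans (cong (frob lam d) (+-comm (suc j) 1)) (frob-< lam 1+j<d)

    frob-last : frob lam d (d + 1) ≡ 0
    frob-last = frob-> lam (subst (d <_) (+-comm 1 d) ≤-refl)

  armConditions⇔frobeniusConditions : ArmConditions ⇔ FrobeniusConditions k lam d
  armConditions⇔frobeniusConditions = mk⇔ to from
    where
    to : ArmConditions → FrobeniusConditions k lam d
    to (c₁ , c₂ , c₃) = f₁ , f₂
      where
      f₁ : ∀ j → 1 ≤ j → j ≤ d → frob lam d j + frob lam d ((d + 1) ∸ j) ≥ k
      f₁ (suc j) _ j<d = subst (k ≤_) (sym (cong₂ _+_ (frob-< lam j<d) (frob-mirror j<d))) (c₁ j j<d)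
      f₂ : ∀ j → 1 ≤ j → j ≤ d → frob lam d (j + 1) + frob lam d ((d + 1) ∸ j) < k
      f₂ (suc j) _ j<d with suc j <? d
      ... | yes 1+j<d = subst (_< k) (sym (cong₂ _+_ (frob-next 1+j<d) (frob-mirror j<d))) (c₂ j 1+j<d)
      ... | no  1+j≮d with ≤-antisym j<d (≮⇒≥ 1+j≮d)
      ...   | refl = subst (_< k) (sym (cong₂ _+_ frob-last (trans (frob-mirror j<d) (cong F (n∸n≡0 j)))))
                            (c₃ (s≤s z≤n))
    from : FrobeniusConditions k lam d → ArmConditions
    from (f₁ , f₂) = c₁ , c₂ , c₃
      where
      c₁ : ∀ j → j < d → k ≤ F j + F (d ∸ suc j)
      c₁ j j<d = subst (k ≤_) (cong₂ _+_ (frob-< lam j<d) (frob-mirror j<d)) (f₁ (suc j) (s≤s z≤n) j<d)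
      c₂ : ∀ j → suc j < d → F (suc j) + F (d ∸ suc j) < k
      c₂ j 1+j<d = subst (_< k) (cong₂ _+_ (frob-next 1+j<d) (frob-mirror j<d))
                         (f₂ (suc j) (s≤s z≤n) (<⇒≤ 1+j<d))
        where j<d = <-trans (n<1+n j) 1+j<d
      c₃ : 0 < d → F 0 < k
      c₃ 0<d = subst (_< k) (cong₂ _+_ frob-last frob-1) (f₂ d 0<d ≤-refl)
        where frob-1 = trans (cong (frob lam d) (m+n∸m≡n d 1)) (frob-< lam 0<d)

-- The content (k^d 1^e)

sum-replicate : ∀ n x → sum (replicate n x) ≡ n * x
sum-replicate zero    x = refl
sum-replicate (suc n) x = cong (x +_) (sum-replicate n x)

module Content (k : ℕ) (1<k : 1 < k) where

  private
    k≢1 : k ≢ 1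
    k≢1 = >⇒≢ 1<k

  replicate-sorted : ∀ n x → Linked _≥_ (replicate n x)
  replicate-sorted zero          x = []
  replicate-sorted (suc zero)    x = [-]
  replicate-sorted (suc (suc n)) x = ≤-refl ∷ replicate-sorted (suc n) x

  kd1e-sorted : ∀ d e → Linked _≥_ (kd1e k d e)
  kd1e-sorted zero          e       = replicate-sorted e 1
  kd1e-sorted (suc zero)    zero    = [-]
  kd1e-sorted (suc zero)    (suc e) = <⇒≤ 1<k ∷ replicate-sorted (suc e) 1
  kd1e-sorted (suc (suc d)) e       = ≤-refl ∷ kd1e-sorted (suc d) e

  kd1e-sizes : ∀ d e → All (IsK∨1 k) (kd1e k d e)
  kd1e-sizes d e = ++⁺ (replicate⁺ d (inj₁ refl)) (replicate⁺ e (inj₂ refl))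

  multiplicity-kd1e : ∀ d e → multiplicity k (kd1e k d e) ≡ d
  multiplicity-kd1e d e = begin
    multiplicity k (replicate d k ++ replicate e 1)                  ≡⟨ multiplicity-++ k (replicate d k) _ ⟩
    multiplicity k (replicate d k) + multiplicity k (replicate e 1)  ≡⟨ cong₂ _+_ (multiplicity-replicate k d) no-k ⟩
    d + 0                                                            ≡⟨ +-identityʳ d ⟩
    d                                                                ∎
    where
    open ≡-Reasoning
    no-k = multiplicity-replicate-≢ e (k≢1 ∘ sym)

  sum-kd1e : ∀ d e → sum (kd1e k d e) ≡ d * k + e
  sum-kd1e d e = trans (sum-++ (replicate d k) (replicate e 1))
                       (cong₂ _+_ (sum-replicate d k) (trans (sum-replicate e 1) (*-identityʳ e)))

  ↭kd1e-multiplicities : ∀ {α} → All (IsK∨1 k) α → α ↭ kd1e k (multiplicity k α) (multiplicity 1 α)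
  ↭kd1e-multiplicities []                   = ↭-refl
  ↭kd1e-multiplicities (_∷_ {xs = α′} (inj₁ refl) sizes)
    rewrite multiplicity-accept {k} α′ refl | multiplicity-reject {1} α′ k≢1 =
      ↭-prep k (↭kd1e-multiplicities sizes)
  ↭kd1e-multiplicities (_∷_ {xs = α′} (inj₂ refl) sizes)
    rewrite multiplicity-reject {k} α′ (k≢1 ∘ sym) | multiplicity-accept {1} α′ refl =
      ↭-trans (↭-prep 1 (↭kd1e-multiplicities sizes))
              (↭-sym (shift 1 (replicate (multiplicity k α′) k) (replicate (multiplicity 1 α′) 1)))

  sum-sizes : ∀ {α} → All (IsK∨1 k) α → sum α ≡ multiplicity k α * k + multiplicity 1 α
  sum-sizes []                   = refl
  sum-sizes (_∷_ {xs = α′} (inj₁ refl) sizes)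
    rewrite multiplicity-accept {k} α′ refl | multiplicity-reject {1} α′ k≢1 | sum-sizes sizes =
      sym (+-assoc k _ _)
  sum-sizes (_∷_ {xs = α′} (inj₂ refl) sizes)
    rewrite multiplicity-reject {k} α′ (k≢1 ∘ sym) | multiplicity-accept {1} α′ refl | sum-sizes sizes =
      sym (+-suc _ _)

  ↭kd1e⇒sizes : ∀ {α} d e → α ↭ kd1e k d e → All (IsK∨1 k) α × multiplicity k α ≡ d
  ↭kd1e⇒sizes d e α↭ =
    All-resp-↭ (↭-sym α↭) (kd1e-sizes d e) , trans (multiplicity-↭ k α↭) (multiplicity-kd1e d e)

  sizes⇒↭kd1e : ∀ {α d e} → All (IsK∨1 k) α → multiplicity k α ≡ d → sum α ≡ sum (kd1e k d e) →
                α ↭ kd1e k d e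
  sizes⇒↭kd1e {α} {d} {e} sizes refl sum≡ = subst (λ b → α ↭ kd1e k d b) ones≡e (↭kd1e-multiplicities sizes)
    where
    ones≡e : multiplicity 1 α ≡ e
    ones≡e = +-cancelˡ-≡ (d * k) _ _ (trans (sym (sum-sizes sizes)) (trans sum≡ (sum-kd1e d e)))

theorem4p14 : (k : ℕ) → 2 ≤ k → (lam : List ℕ) → IsPartition lam →
    (d : ℕ) → HasRank lam d → IsASC lam d → (e : ℕ) →
    sum (kd1e k d e) ≡ sum lam →
    SRHTNonempty lam (kd1e k d e) ⇔
      ((∀ j → 1 ≤ j → j ≤ d → frob lam d j + frob lam d ((d + 1) ∸ j) ≥ k)
       × (∀ j → 1 ≤ j → j ≤ d → frob lam d (j + 1) + frob lam d ((d + 1) ∸ j) < k))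
theorem4p14 k 1<k lam P d rank asc e sum≡ = mk⇔ to from
  where
  open AlmostSelfConjugate k P rank asc
  open FirstColumnDecompositions N k 1<k
  open Content k 1<k
  open Equivalence armConditions⇔frobeniusConditions renaming (to to toFrobenius; from to fromFrobenius)

  to : SRHTNonempty lam (kd1e k d e) → FrobeniusConditions k lam d
  to (α , t , (α↭kd1e , _) , meets) =
    toFrobenius (tight⇒armConditions (proj₂ bound (trans mult≡d (sym durfee≡d))))
    where
    sizes  = proj₁ (↭kd1e⇒sizes d e α↭kd1e)
    mult≡d = proj₂ (↭kd1e⇒sizes d e α↭kd1e)
    bound  = durfee≤multiplicity t meets sizes ≤-refl gapN

  from : FrobeniusConditions k lam d → SRHTNonempty lam (kd1e k d e)
  from conditions
    with greedyDecomposition N ≤-refl P ≤-refl gapN (armConditions⇒tight (fromFrobenius conditions))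
  ... | α , t , meets , sizes , mult≡ , sum-α≡ =
    α , t , (sizes⇒↭kd1e sizes (trans mult≡ durfee≡d) (trans sum-α≡ (sym sum≡)) , kd1e-sorted d e) , meets
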